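{- There exist absolute positive constants $C_1,C_2$ such that for all $\varepsilon\in(0,1)$, all integers $N\ge1$, all integers $K\ge2$ and all primes $p>C_1/\varepsilon$, \[ \frac{1}{\#\mathcal V(p,N)^K}\#\Big\{(\beta_1,\dots,\beta_K)\in\mathcal V(p,N)^K:\ \max_{1\le j<k\le K}\Big|\mathfrak d_{p,N}(\beta_j,\beta_k)-\tfrac1{\sqrt2}\Big|\le\varepsilon\Big\}\ \ge\ 1-\frac{C_2K^2}{\varepsilon^2p}. \]
   Context: Let $p$ be an odd prime, $\omega=\exp(2\pi i/p)$, $\mathbb{Q}(\omega)$ with $\mathbb{Q}$-basis $\omega,\dots,\omega^{p-1}$. For $\gamma\in\mathbb{Q}(\omega)$, $\mathrm{Tr}(\gamma)=\sum_{\sigma\in\mathrm{Gal}(\mathbb{Q}(\omega)/\mathbb{Q})}\sigma(\gamma)$, $\psi(\gamma)=(\mathrm{Tr}(\gamma\omega),\dots,\mathrm{Tr}(\gamma\omega^{p-1}))$, $\|\gamma\|$ is the Euclidean norm of $\psi(\gamma)$, $d(\alpha,\beta)=\|\beta-\alpha\|$, and $\mathfrak d_{p,N}(\alpha,\beta)=d(\alpha,\beta)/(2Np(p-1)^{1/2})$. For an integer $N\ge1$, $\mathcal V(p,N)=\{\sum_{j=1}^{p-1}a_j\omega^j: a_j\in\{ -N,N\}\}$.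
   Formalization: The parameter ε ranges over the rationals in (0,1) rather than the reals, and the constants C₁, C₂ are taken rational. -}

module Defs where

open import Data.Bool using (Bool; true; false; if_then_else_; _∧_; _∨_)
open import Data.Nat as ℕ using (ℕ; zero; suc; _∸_; _<?_; _≡ᵇ_; _<ᵇ_)
open import Data.Nat.DivMod using (_%_)
open import Data.Fin using (Fin; toℕ; fromℕ<)
open import Data.Integer as ℤ using (ℤ; +_)
open import Data.Rational as ℚ using (ℚ; _≤ᵇ_)
open import Data.List as L using (List; []; _∷_; allFin; concatMap; map; length; filterᵇ)
open import Data.Bool.ListAction using (and)
open import Data.Vec as V using (Vec; []; _∷_; lookup)
open import Relation.Nullary.Decidable using (yes; no)

-- Elements of ℤ[ω] ⊂ ℚ(ω), ω = exp(2πi/p), represented by a function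
-- f : ℕ → ℤ standing for  Σ_{j<p} f j · ω^j  (only j < p is used).
-- The coordinate on the basis ω,…,ω^{p-1} at ω^m (1 ≤ m ≤ p-1) is
-- f m - f 0  (since 1 = -(ω + … + ω^{p-1})).

Elt : Set
Elt = ℕ → ℤ

-- reduction mod p (written with suc (p ∸ 1) so that no NonZero instance
-- is needed; equals x mod p for p ≥ 1)
_mod_ : ℕ → ℕ → ℕ
x mod p = x % suc (p ∸ 1)

sumℤ : ℕ → (ℕ → ℤ) → ℤ
sumℤ zero    f = + 0
sumℤ (suc n) f = sumℤ n f ℤ.+ f n

-- the element Σ_{j=1}^{p-1} a_j ω^j from its coordinate vector
-- (a j) at index j ↦ coefficient of ω^{j+1}
fromCoords : (p : ℕ) → (Fin (p ∸ 1) → ℤ) → Elt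
fromCoords p a zero = + 0
fromCoords p a (suc i) with i <? (p ∸ 1)
... | yes i<n = a (fromℕ< i<n)
... | no  _   = + 0

_−ᴱ_ : Elt → Elt → Elt
(f −ᴱ g) j = f j ℤ.- g j

mulω^ : (p k : ℕ) → Elt → Elt
mulω^ p k f j = f ((j ℕ.+ (p ∸ (k mod p))) mod p)

-- the Galois automorphism σ_t : ω ↦ ω^t  (1 ≤ t ≤ p-1)
σ : (p t : ℕ) → Elt → Elt
σ p t f j = sumℤ p (λ i → if ((i ℕ.* t) mod p) ≡ᵇ (j mod p) then f i else + 0)

TrElt : ℕ → Elt → Elt
TrElt p f j = sumℤ (p ∸ 1) (λ t → σ p (suc t) f j)

-- value of an element known to be rational: g = q ⇔ all basis
-- coordinates equal -q, so q = g 0 - g 1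
ratValue : Elt → ℤ
ratValue g = g 0 ℤ.- g 1

Tr : ℕ → Elt → ℤ
Tr p γ = ratValue (TrElt p γ)

ψ : ℕ → Elt → ℕ → ℤ
ψ p γ k = Tr p (mulω^ p k γ)

normSq : ℕ → Elt → ℤ
normSq p γ = sumℤ (p ∸ 1) (λ k → ψ p γ (suc k) ℤ.* ψ p γ (suc k))

distSq : ℕ → Elt → Elt → ℤ
distSq p α β = normSq p (β −ᴱ α)

toℚ : ℤ → ℚ
toℚ z = z ℚ./ 1

ℕtoℚ : ℕ → ℚ
ℕtoℚ n = + n ℚ./ 1

-- (the denominator is written suc (M ∸ 1), which equals M = 4N²p²(p-1)
-- whenever M ≥ 1, i.e. for N ≥ 1 and p ≥ 2)
𝔡Sq : ℕ → ℕ → Elt → Elt → ℚ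
𝔡Sq p N α β = distSq p α β ℚ./ suc ((4 ℕ.* N ℕ.* N ℕ.* p ℕ.* p ℕ.* (p ∸ 1)) ∸ 1)

-- Exact test of  √u ≤ √v + e  for rationals u, v, e ≥ 0:
--   √u ≤ √v + e  ⇔  u - v - e² ≤ 2e√v
--                ⇔  u - v - e² ≤ 0  ∨  (u - v - e²)² ≤ 4e²v .
sqrtLeᵇ : ℚ → ℚ → ℚ → Bool
sqrtLeᵇ u v e =
  let w = u ℚ.- v ℚ.- e ℚ.* e in
  (w ≤ᵇ ℚ.0ℚ) ∨ (w ℚ.* w ≤ᵇ ℕtoℚ 4 ℚ.* e ℚ.* e ℚ.* v)

sqrtCloseᵇ : ℚ → ℚ → ℚ → Bool
sqrtCloseᵇ u v e = sqrtLeᵇ u v e ∧ sqrtLeᵇ v u e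

-- | 𝔡_{p,N}(α,β) − 1/√2 | ≤ ε   (𝔡 = √𝔡Sq, 1/√2 = √(1/2))
𝔡Closeᵇ : ℕ → ℕ → ℚ → Elt → Elt → Bool
𝔡Closeᵇ p N ε α β = sqrtCloseᵇ (𝔡Sq p N α β) ℚ.½ ε

-- 𝒱(p,N): elements Σ_j a_j ω^j with a_j ∈ {-N, N}; encoded by a sign
-- vector (the coordinate map is a bijection onto 𝒱(p,N) since N ≥ 1
-- and ω,…,ω^{p-1} is a basis).

signVecs : (n : ℕ) → List (Vec Bool n)
signVecs zero    = [] ∷ []
signVecs (suc n) = concatMap (λ v → (false ∷ v) ∷ (true ∷ v) ∷ []) (signVecs n)

signToℤ : ℕ → Bool → ℤ
signToℤ N true  = + N
signToℤ N false = ℤ.- (+ N)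

elt : (p N : ℕ) → Vec Bool (p ∸ 1) → Elt
elt p N s = fromCoords p (λ j → signToℤ N (lookup s j))

tuples : {A : Set} → (K : ℕ) → List A → List (Vec A K)
tuples zero    xs = [] ∷ []
tuples (suc K) xs = concatMap (λ x → map (x ∷_) (tuples K xs)) xs

𝒱tuples : (p N K : ℕ) → List (Vec Elt K)
𝒱tuples p N K = map (V.map (elt p N)) (tuples K (signVecs (p ∸ 1)))

goodᵇ : (p N : ℕ) → ℚ → {K : ℕ} → Vec Elt K → Bool
goodᵇ p N ε {K} βs =
  and (concatMap (λ j → map (λ k →
        if toℕ j ℕ.<ᵇ toℕ k
          then 𝔡Closeᵇ p N ε (lookup βs j) (lookup βs k)
          else true) (allFin K)) (allFin K))

countGood : (p N K : ℕ) → ℚ → ℕ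
countGood p N K ε = length (filterᵇ (goodᵇ p N ε) (𝒱tuples p N K))

countAll : (p N K : ℕ) → ℕ
countAll p N K = length (𝒱tuples p N K)

{-# OPTIONS --safe #-}

-- For sign vectors x, y ∈ {±1}ⁿ, n = p − 1, put β_x = N Σᵢ xᵢ ωⁱ. Since Tr(ωʲ) = −1 for p ∤ j,
-- every g = Σ_{j ≥ 1} gⱼ ωʲ has ‖g‖² = p² Σ gⱼ² − (p + 1)(Σ gⱼ)², hence
-- 𝔡(β_x, β_y)² = (p² H − (p + 1) T²)/(p² n) with H the Hamming distance of x and y and
-- T = Σ (yᵢ − xᵢ)/2. Writing X = 2H − n this is ½ + X/(2n) − (p + 1)T²/(p² n), so 𝔡 is within ε
-- of 1/√2 as soon as 8|X| ≤ εn and 8|T| ≤ εn. Coordinatewise E χ² = 1 and E τ² = ½ give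
-- Σ_{x,y} (X² + T²) = (3n/2)·4ⁿ, so by Chebyshev at most a 192/(ε²p) fraction of the pairs is
-- bad. A K-tuple is bad only if one of its K² coordinate pairs is, and two distinct coordinates
-- of a uniform tuple form a uniform pair; this gives the bound with C₂ = 192 for every prime p.

module Submission where

open import Data.Bool using (Bool; true; false; T; if_then_else_)
open import Data.Empty using (⊥-elim)
open import Data.Integer as ℤ using (ℤ)
import Data.Integer.Properties as ℤ
open import Data.Integer.Tactic.RingSolver as ℤ-Solver using ()
open import Data.List using (List; []; _∷_; map; concatMap; length; filterᵇ)
open import Data.Nat as ℕ using (ℕ; zero; suc; z≤n; s≤s)
import Data.Nat.Properties as ℕ
open import Data.Nat.Tactic.RingSolver as ℕ-Solver using ()
open import Data.Product using (Σ; ∃-syntax; _×_; _,_)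
open import Data.Vec as Vec using (Vec; lookup)
open import Function using (_∘_; Equivalence)
open import Relation.Binary.PropositionalEquality
open import Relation.Nullary using (yes; no)
open import Tactic.RingSolver as ℚ-Solver using ()

open import Defs

private
  variable
    A B : Set

module ListSums where

  open import Algebra.Properties.CommutativeSemigroup ℕ.+-commutativeSemigroup using (interchange)
  open import Data.Bool.ListAction using (and)
  open import Data.List using (_++_)
  open import Data.List.Properties using (length-++)
  open import Data.Nat using (_+_; _*_; _≤_)
  open import Data.Nat.Properties

  ∑ : List A → (A → ℕ) → ℕ
  ∑ []       f = 0
  ∑ (x ∷ xs) f = f x + ∑ xs f

  ∑-syntax : List A → (A → ℕ) → ℕ
  ∑-syntax = ∑

  infix 5 ∑-syntax
  syntax ∑-syntax xs (λ x → e) = ∑[ x ∈ xs ] e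

  ∑-cong : (xs : List A) {f g : A → ℕ} → (∀ x → f x ≡ g x) → ∑ xs f ≡ ∑ xs g
  ∑-cong []       f≡g = refl
  ∑-cong (x ∷ xs) f≡g = cong₂ _+_ (f≡g x) (∑-cong xs f≡g)

  ∑-mono-≤ : (xs : List A) {f g : A → ℕ} → (∀ x → f x ≤ g x) → ∑ xs f ≤ ∑ xs g
  ∑-mono-≤ []       f≤g = z≤n
  ∑-mono-≤ (x ∷ xs) f≤g = +-mono-≤ (f≤g x) (∑-mono-≤ xs f≤g)

  ∑-const : (xs : List A) (c : ℕ) → ∑ xs (λ _ → c) ≡ length xs * c
  ∑-const []       c = refl
  ∑-const (x ∷ xs) c = cong (c +_) (∑-const xs c)

  ∑-*ˡ : (xs : List A) (c : ℕ) (f : A → ℕ) → ∑[ x ∈ xs ] c * f x ≡ c * ∑ xs f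
  ∑-*ˡ []       c f = sym (*-zeroʳ c)
  ∑-*ˡ (x ∷ xs) c f = trans (cong (c * f x +_) (∑-*ˡ xs c f)) (sym (*-distribˡ-+ c (f x) _))

  ∑-+ : (xs : List A) (f g : A → ℕ) → ∑[ x ∈ xs ] (f x + g x) ≡ ∑ xs f + ∑ xs g
  ∑-+ []       f g = refl
  ∑-+ (x ∷ xs) f g = trans (cong (f x + g x +_) (∑-+ xs f g)) (interchange (f x) (g x) _ _)

  ∑-comm : (xs : List A) (ys : List B) (f : A → B → ℕ) →
           ∑[ x ∈ xs ] ∑[ y ∈ ys ] f x y ≡ ∑[ y ∈ ys ] ∑[ x ∈ xs ] f x y
  ∑-comm []       ys f = sym (trans (∑-const ys 0) (*-zeroʳ (length ys)))
  ∑-comm (x ∷ xs) ys f = trans (cong (∑ ys (f x) +_) (∑-comm xs ys f)) (sym (∑-+ ys (f x) _))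

  ∑-++ : (xs ys : List A) (f : A → ℕ) → ∑ (xs ++ ys) f ≡ ∑ xs f + ∑ ys f
  ∑-++ []       ys f = refl
  ∑-++ (x ∷ xs) ys f = trans (cong (f x +_) (∑-++ xs ys f)) (sym (+-assoc (f x) _ _))

  ∑-map : (g : A → B) (xs : List A) (f : B → ℕ) → ∑ (map g xs) f ≡ ∑[ x ∈ xs ] f (g x)
  ∑-map g []       f = refl
  ∑-map g (x ∷ xs) f = cong (f (g x) +_) (∑-map g xs f)

  ∑-concatMap : (g : A → List B) (xs : List A) (f : B → ℕ) → ∑ (concatMap g xs) f ≡ ∑[ x ∈ xs ] ∑ (g x) f
  ∑-concatMap g []       f = refl
  ∑-concatMap g (x ∷ xs) f = trans (∑-++ (g x) _ f) (cong (∑ (g x) f +_) (∑-concatMap g xs f))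

  length-concatMap : (g : A → List B) (xs : List A) → length (concatMap g xs) ≡ ∑[ x ∈ xs ] length (g x)
  length-concatMap g []       = refl
  length-concatMap g (x ∷ xs) = trans (length-++ (g x)) (cong (length (g x) +_) (length-concatMap g xs))

  isFalse : Bool → ℕ
  isFalse false = 1
  isFalse true  = 0

  isFalse-and : (bs : List Bool) → isFalse (and bs) ≤ ∑ bs isFalse
  isFalse-and []           = z≤n
  isFalse-and (true ∷ bs)  = isFalse-and bs
  isFalse-and (false ∷ bs) = s≤s z≤n

  length-filterᵇ+∑isFalse : (P : A → Bool) (xs : List A) →
                            length (filterᵇ P xs) + (∑[ x ∈ xs ] isFalse (P x)) ≡ length xs
  length-filterᵇ+∑isFalse P []       = refl
  length-filterᵇ+∑isFalse P (x ∷ xs) with P x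
  ... | true  = cong suc (length-filterᵇ+∑isFalse P xs)
  ... | false = trans (+-suc _ _) (cong suc (length-filterᵇ+∑isFalse P xs))

open ListSums

module TupleCounting where

  open import Data.Bool.ListAction using (and)
  open import Data.Fin using (Fin; toℕ) renaming (zero to fzero; suc to fsuc)
  open import Data.List using (allFin)
  open import Data.List.Properties using (length-map; length-tabulate; map-∘; concatMap-map; map-concatMap; concatMap-cong)
  open import Data.Nat using (_*_; _^_; _≤_; _<ᵇ_)
  open import Data.Nat.Properties

  module _ {A : Set} (W : List A) where

    private
      w = length W

    length-tuples : (K : ℕ) → length (tuples K W) ≡ w ^ K
    length-tuples zero    = refl
    length-tuples (suc K) = begin
      length (concatMap (λ a → map (a Vec.∷_) (tuples K W)) W)
        ≡⟨ length-concatMap _ W ⟩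
      ∑[ a ∈ W ] length (map (a Vec.∷_) (tuples K W))
        ≡⟨ ∑-cong W (λ a → trans (length-map _ (tuples K W)) (length-tuples K)) ⟩
      ∑[ a ∈ W ] w ^ K
        ≡⟨ ∑-const W (w ^ K) ⟩
      w * w ^ K
        ∎
      where open ≡-Reasoning

    ∑-tuples-suc : (K : ℕ) (F : Vec A (suc K) → ℕ) →
                   ∑ (tuples (suc K) W) F ≡ ∑[ a ∈ W ] ∑[ t ∈ tuples K W ] F (a Vec.∷ t)
    ∑-tuples-suc K F = trans (∑-concatMap _ W F) (∑-cong W (λ a → ∑-map (a Vec.∷_) (tuples K W) F))

    ∑-tuples-lookup : (K : ℕ) (j : Fin (suc K)) (h : A → ℕ) →
                      ∑[ t ∈ tuples (suc K) W ] h (lookup t j) ≡ w ^ K * ∑ W h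
    ∑-tuples-lookup K fzero h = begin
      ∑[ t ∈ tuples (suc K) W ] h (lookup t fzero)
        ≡⟨ ∑-tuples-suc K _ ⟩
      ∑[ a ∈ W ] ∑[ t ∈ tuples K W ] h a
        ≡⟨ ∑-cong W (λ a → trans (∑-const (tuples K W) (h a)) (cong (_* h a) (length-tuples K))) ⟩
      ∑[ a ∈ W ] w ^ K * h a
        ≡⟨ ∑-*ˡ W (w ^ K) h ⟩
      w ^ K * ∑ W h
        ∎
      where open ≡-Reasoning
    ∑-tuples-lookup (suc K) (fsuc j) h = begin
      ∑[ t ∈ tuples (suc (suc K)) W ] h (lookup t (fsuc j))
        ≡⟨ ∑-tuples-suc (suc K) _ ⟩
      ∑[ a ∈ W ] ∑[ t ∈ tuples (suc K) W ] h (lookup t j)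
        ≡⟨ ∑-cong W (λ _ → ∑-tuples-lookup K j h) ⟩
      ∑[ a ∈ W ] w ^ K * ∑ W h
        ≡⟨ ∑-const W _ ⟩
      w * (w ^ K * ∑ W h)
        ≡⟨ *-assoc w (w ^ K) _ ⟨
      w ^ suc K * ∑ W h
        ∎
      where open ≡-Reasoning

    ∑∑ : (A → A → ℕ) → ℕ
    ∑∑ g = ∑[ a ∈ W ] ∑[ b ∈ W ] g a b

    ∑-tuples-lookup₂ : (K : ℕ) (j k : Fin (suc (suc K))) → j ≢ k → (g : A → A → ℕ) →
                       ∑[ t ∈ tuples (suc (suc K)) W ] g (lookup t j) (lookup t k) ≡ w ^ K * ∑∑ g
    ∑-tuples-lookup₂ K fzero fzero j≢k g = ⊥-elim (j≢k refl)
    ∑-tuples-lookup₂ K fzero (fsuc k) _ g = begin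
      ∑[ t ∈ tuples (suc (suc K)) W ] g (lookup t fzero) (lookup t (fsuc k))
        ≡⟨ ∑-tuples-suc (suc K) _ ⟩
      ∑[ a ∈ W ] ∑[ t ∈ tuples (suc K) W ] g a (lookup t k)
        ≡⟨ ∑-cong W (λ a → ∑-tuples-lookup K k (g a)) ⟩
      ∑[ a ∈ W ] w ^ K * ∑ W (g a)
        ≡⟨ ∑-*ˡ W (w ^ K) _ ⟩
      w ^ K * ∑∑ g
        ∎
      where open ≡-Reasoning
    ∑-tuples-lookup₂ K (fsuc j) fzero _ g = begin
      ∑[ t ∈ tuples (suc (suc K)) W ] g (lookup t (fsuc j)) (lookup t fzero)
        ≡⟨ ∑-tuples-suc (suc K) _ ⟩
      ∑[ b ∈ W ] ∑[ t ∈ tuples (suc K) W ] g (lookup t j) b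
        ≡⟨ ∑-cong W (λ b → ∑-tuples-lookup K j (λ a → g a b)) ⟩
      ∑[ b ∈ W ] w ^ K * (∑[ a ∈ W ] g a b)
        ≡⟨ ∑-*ˡ W (w ^ K) _ ⟩
      w ^ K * (∑[ b ∈ W ] ∑[ a ∈ W ] g a b)
        ≡⟨ cong (w ^ K *_) (∑-comm W W (λ b a → g a b)) ⟩
      w ^ K * ∑∑ g
        ∎
      where open ≡-Reasoning
    ∑-tuples-lookup₂ zero    (fsuc fzero) (fsuc fzero) j≢k g = ⊥-elim (j≢k refl)
    ∑-tuples-lookup₂ (suc K) (fsuc j)     (fsuc k)     j≢k g = begin
      ∑[ t ∈ tuples (suc (suc (suc K))) W ] g (lookup t (fsuc j)) (lookup t (fsuc k))
        ≡⟨ ∑-tuples-suc (suc (suc K)) _ ⟩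
      ∑[ a ∈ W ] ∑[ t ∈ tuples (suc (suc K)) W ] g (lookup t j) (lookup t k)
        ≡⟨ ∑-cong W (λ _ → ∑-tuples-lookup₂ K j k (j≢k ∘ cong fsuc) g) ⟩
      ∑[ a ∈ W ] w ^ K * ∑∑ g
        ≡⟨ ∑-const W _ ⟩
      w * (w ^ K * ∑∑ g)
        ≡⟨ *-assoc w (w ^ K) _ ⟨
      w ^ suc K * ∑∑ g
        ∎
      where open ≡-Reasoning

  module _ {A : Set} (r : A → A → Bool) where

    orderedPairᵇ : {K : ℕ} → Vec A K → Fin K → Fin K → Bool
    orderedPairᵇ t j k = if toℕ j <ᵇ toℕ k then r (lookup t j) (lookup t k) else true

    pairwiseᵇ : {K : ℕ} → Vec A K → Bool
    pairwiseᵇ {K} t = and (concatMap (λ j → map (orderedPairᵇ t j) (allFin K)) (allFin K))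

    isFalse-pairwiseᵇ : {K : ℕ} (t : Vec A K) →
                        isFalse (pairwiseᵇ t) ≤ ∑[ j ∈ allFin K ] ∑[ k ∈ allFin K ] isFalse (orderedPairᵇ t j k)
    isFalse-pairwiseᵇ {K} t = ≤-trans (isFalse-and tests) (≤-reflexive (begin
      ∑ tests isFalse
        ≡⟨ ∑-concatMap (λ j → map (orderedPairᵇ t j) (allFin K)) (allFin K) isFalse ⟩
      ∑[ j ∈ allFin K ] ∑ (map (orderedPairᵇ t j) (allFin K)) isFalse
        ≡⟨ ∑-cong (allFin K) (λ j → ∑-map (orderedPairᵇ t j) (allFin K) isFalse) ⟩
      ∑[ j ∈ allFin K ] ∑[ k ∈ allFin K ] isFalse (orderedPairᵇ t j k) ∎))
      where
      open ≡-Reasoning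
      tests = concatMap (λ j → map (orderedPairᵇ t j) (allFin K)) (allFin K)

    module _ (W : List A) where

      badPairs : ℕ
      badPairs = ∑∑ W (λ a b → isFalse (r a b))

      ∑-isFalse-orderedPairᵇ≤ : (K : ℕ) (j k : Fin (suc (suc K))) →
        ∑[ t ∈ tuples (suc (suc K)) W ] isFalse (orderedPairᵇ t j k) ≤ length W ^ K * badPairs
      ∑-isFalse-orderedPairᵇ≤ K j k with toℕ j <ᵇ toℕ k in j<k
      ... | true  = ≤-reflexive (∑-tuples-lookup₂ W K j k j≢k (λ a b → isFalse (r a b)))
        where
        j≢k : j ≢ k
        j≢k refl = <-irrefl refl (<ᵇ⇒< (toℕ j) (toℕ j) (subst T (sym j<k) _))
      ... | false = ≤-trans (≤-reflexive (trans (∑-const T₂ 0) (*-zeroʳ (length T₂)))) z≤n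
        where T₂ = tuples (suc (suc K)) W

      ∑-isFalse-pairwiseᵇ≤ : (K : ℕ) →
        ∑[ t ∈ tuples (suc (suc K)) W ] isFalse (pairwiseᵇ t) ≤ suc (suc K) * suc (suc K) * (length W ^ K * badPairs)
      ∑-isFalse-pairwiseᵇ≤ K = begin
        ∑[ t ∈ tuples K₂ W ] isFalse (pairwiseᵇ t)
          ≤⟨ ∑-mono-≤ (tuples K₂ W) isFalse-pairwiseᵇ ⟩
        ∑[ t ∈ tuples K₂ W ] ∑[ j ∈ positions ] ∑[ k ∈ positions ] isFalse (orderedPairᵇ t j k)
          ≡⟨ ∑-comm (tuples K₂ W) positions _ ⟩
        ∑[ j ∈ positions ] ∑[ t ∈ tuples K₂ W ] ∑[ k ∈ positions ] isFalse (orderedPairᵇ t j k)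
          ≡⟨ ∑-cong positions (λ j → ∑-comm (tuples K₂ W) positions _) ⟩
        ∑[ j ∈ positions ] ∑[ k ∈ positions ] ∑[ t ∈ tuples K₂ W ] isFalse (orderedPairᵇ t j k)
          ≤⟨ ∑-mono-≤ positions (λ j → ∑-mono-≤ positions (∑-isFalse-orderedPairᵇ≤ K j)) ⟩
        ∑[ j ∈ positions ] ∑[ k ∈ positions ] length W ^ K * badPairs
          ≡⟨ trans (∑-cong positions (λ _ → ∑-const positions bound)) (∑-const positions (length positions * bound)) ⟩
        length positions * (length positions * (length W ^ K * badPairs))
          ≡⟨ cong (λ l → l * (l * (length W ^ K * badPairs))) (length-tabulate {n = K₂} (λ i → i)) ⟩
        K₂ * (K₂ * (length W ^ K * badPairs))
          ≡⟨ *-assoc K₂ K₂ bound ⟨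
        K₂ * K₂ * (length W ^ K * badPairs) ∎
        where
        open ≤-Reasoning
        K₂ = suc (suc K)
        positions = allFin K₂
        bound = length W ^ K * badPairs

  tuples-map : (e : A → B) (K : ℕ) (xs : List A) → tuples K (map e xs) ≡ map (Vec.map e) (tuples K xs)
  tuples-map e zero    xs = refl
  tuples-map e (suc K) xs = begin
    concatMap (λ b → map (b Vec.∷_) (tuples K (map e xs))) (map e xs)
      ≡⟨ cong (λ ts → concatMap (λ b → map (b Vec.∷_) ts) (map e xs)) (tuples-map e K xs) ⟩
    concatMap (λ b → map (b Vec.∷_) (map (Vec.map e) ts)) (map e xs)
      ≡⟨ concatMap-map (λ b → map (b Vec.∷_) (map (Vec.map e) ts)) e xs ⟩
    concatMap (λ a → map (e a Vec.∷_) (map (Vec.map e) ts)) xs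
      ≡⟨ concatMap-cong (λ a → trans (sym (map-∘ ts)) (map-∘ ts)) xs ⟩
    concatMap (λ a → map (Vec.map e) (map (a Vec.∷_) ts)) xs
      ≡⟨ map-concatMap (Vec.map e) (λ a → map (a Vec.∷_) ts) xs ⟨
    map (Vec.map e) (concatMap (λ a → map (a Vec.∷_) ts) xs) ∎
    where
    open ≡-Reasoning
    ts = tuples K xs

open TupleCounting

module RangeSums where

  open import Algebra.Properties.CommutativeSemigroup ℤ.+-commutativeSemigroup using (interchange)
  open import Data.Integer using (+_; _+_; _*_; _-_)
  open import Data.Nat using (_∸_; _<_; _≤_)
  open import Data.Nat.DivMod using (_%_; m<n⇒m%n≡m; [m+n]%n≡m%n)

  sumℤ-cong : (n : ℕ) {f g : ℕ → ℤ} → (∀ i → i < n → f i ≡ g i) → sumℤ n f ≡ sumℤ n g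
  sumℤ-cong zero    f≡g = refl
  sumℤ-cong (suc n) f≡g = cong₂ _+_ (sumℤ-cong n (λ i i<n → f≡g i (ℕ.m<n⇒m<1+n i<n))) (f≡g n ℕ.≤-refl)

  sumℤ-suc : (n : ℕ) (f : ℕ → ℤ) → sumℤ (suc n) f ≡ f 0 + sumℤ n (f ∘ suc)
  sumℤ-suc zero    f = trans (ℤ.+-identityˡ (f 0)) (sym (ℤ.+-identityʳ (f 0)))
  sumℤ-suc (suc n) f = trans (cong (_+ f (suc n)) (sumℤ-suc n f)) (ℤ.+-assoc (f 0) _ _)

  sumℤ-const : (n : ℕ) (c : ℤ) → sumℤ n (λ _ → c) ≡ + n * c
  sumℤ-const zero    c = sym (ℤ.*-zeroˡ c)
  sumℤ-const (suc n) c = trans (cong (_+ c) (sumℤ-const n c)) (trans (ℤ.+-comm _ c) (sym (ℤ.suc-* (+ n) c)))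

  sumℤ-zero : (n : ℕ) {f : ℕ → ℤ} → (∀ i → i < n → f i ≡ + 0) → sumℤ n f ≡ + 0
  sumℤ-zero n f≡0 = trans (sumℤ-cong n f≡0) (trans (sumℤ-const n (+ 0)) (ℤ.*-zeroʳ (+ n)))

  sumℤ-+ : (n : ℕ) (f g : ℕ → ℤ) → sumℤ n (λ i → f i + g i) ≡ sumℤ n f + sumℤ n g
  sumℤ-+ zero    f g = refl
  sumℤ-+ (suc n) f g = trans (cong (_+ (f n + g n)) (sumℤ-+ n f g)) (interchange (sumℤ n f) (sumℤ n g) (f n) (g n))

  sumℤ-comm : (n m : ℕ) (F : ℕ → ℕ → ℤ) →
              sumℤ n (λ i → sumℤ m (F i)) ≡ sumℤ m (λ j → sumℤ n (λ i → F i j))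
  sumℤ-comm zero    m F = sym (sumℤ-zero m (λ _ _ → refl))
  sumℤ-comm (suc n) m F = trans (cong (_+ sumℤ m (F n)) (sumℤ-comm n m F)) (sym (sumℤ-+ m _ (F n)))

  sumℤ-[af-b]² : (k : ℕ) (a b : ℤ) (f : ℕ → ℤ) →
    sumℤ k (λ i → (a * f i - b) * (a * f i - b))
      ≡ a * a * sumℤ k (λ i → f i * f i) - + 2 * a * b * sumℤ k f + + k * (b * b)
  sumℤ-[af-b]² zero    a b f = ℤ-Solver.solve (a ∷ b ∷ [])
  sumℤ-[af-b]² (suc k) a b f = begin
    sumℤ k (λ i → (a * f i - b) * (a * f i - b)) + (a * f k - b) * (a * f k - b)
      ≡⟨ cong (_+ (a * f k - b) * (a * f k - b)) (sumℤ-[af-b]² k a b f) ⟩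
    a * a * sumℤ k (λ i → f i * f i) - + 2 * a * b * sumℤ k f + + k * (b * b) + (a * f k - b) * (a * f k - b)
      ≡⟨ step a b (sumℤ k (λ i → f i * f i)) (sumℤ k f) (f k) (+ k) ⟩
    a * a * (sumℤ k (λ i → f i * f i) + f k * f k) - + 2 * a * b * (sumℤ k f + f k) + (+ 1 + + k) * (b * b) ∎
    where
    open ≡-Reasoning
    step : ∀ a b s₂ s₁ x k → a * a * s₂ - + 2 * a * b * s₁ + k * (b * b) + (a * x - b) * (a * x - b)
                           ≡ a * a * (s₂ + x * x) - + 2 * a * b * (s₁ + x) + (+ 1 + k) * (b * b)
    step = ℤ-Solver.solve-∀

  sumℤ-split : (a b : ℕ) (f : ℕ → ℤ) → sumℤ (a ℕ.+ b) f ≡ sumℤ a f + sumℤ b (λ i → f (a ℕ.+ i))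
  sumℤ-split a zero    f = trans (cong (λ k → sumℤ k f) (ℕ.+-identityʳ a)) (sym (ℤ.+-identityʳ _))
  sumℤ-split a (suc b) f = begin
    sumℤ (a ℕ.+ suc b) f                                  ≡⟨ cong (λ k → sumℤ k f) (ℕ.+-suc a b) ⟩
    sumℤ (a ℕ.+ b) f + f (a ℕ.+ b)                        ≡⟨ cong (_+ f (a ℕ.+ b)) (sumℤ-split a b f) ⟩
    sumℤ a f + sumℤ b (λ i → f (a ℕ.+ i)) + f (a ℕ.+ b)  ≡⟨ ℤ.+-assoc (sumℤ a f) _ _ ⟩
    sumℤ a f + sumℤ (suc b) (λ i → f (a ℕ.+ i))           ∎
    where open ≡-Reasoning

  sumℤ-δ : (n i₀ : ℕ) {f : ℕ → ℤ} → i₀ < n → (∀ i → i < n → i ≢ i₀ → f i ≡ + 0) → sumℤ n f ≡ f i₀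
  sumℤ-δ (suc n) i₀ {f} i₀<1+n f≡0 with i₀ ℕ.≟ n
  ... | yes refl = trans (cong (_+ f i₀) (sumℤ-zero n (λ i i<n → f≡0 i (ℕ.m<n⇒m<1+n i<n) (ℕ.<⇒≢ i<n))))
                         (ℤ.+-identityˡ (f i₀))
  ... | no i₀≢n  = trans (cong₂ _+_ (sumℤ-δ n i₀ (ℕ.≤∧≢⇒< (ℕ.s≤s⁻¹ i₀<1+n) i₀≢n) (λ i i<n → f≡0 i (ℕ.m<n⇒m<1+n i<n)))
                                    (f≡0 n ℕ.≤-refl (i₀≢n ∘ sym)))
                         (ℤ.+-identityʳ (f i₀))

  sumℤ-reverse : (n : ℕ) (f : ℕ → ℤ) → sumℤ n (λ k → f (n ∸ k)) ≡ sumℤ n (f ∘ suc)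
  sumℤ-reverse zero    f = refl
  sumℤ-reverse (suc n) f = begin
    sumℤ n (λ k → f (suc n ∸ k)) + f (suc n ∸ n)  ≡⟨ cong₂ _+_ (sumℤ-cong n (λ k k<n → cong f (ℕ.+-∸-assoc 1 (ℕ.<⇒≤ k<n))))
                                                             (cong f (ℕ.m+n∸n≡m 1 n)) ⟩
    sumℤ n (λ k → f (suc (n ∸ k))) + f 1          ≡⟨ cong (_+ f 1) (sumℤ-reverse n (f ∘ suc)) ⟩
    sumℤ n (f ∘ suc ∘ suc) + f 1                  ≡⟨ ℤ.+-comm _ (f 1) ⟩
    f 1 + sumℤ n (f ∘ suc ∘ suc)                  ≡⟨ sumℤ-suc n (f ∘ suc) ⟨
    sumℤ (suc n) (f ∘ suc)                        ∎
    where open ≡-Reasoning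

  sumℤ-rotate : (p r : ℕ) .{{_ : ℕ.NonZero p}} → r ≤ p → (g : ℕ → ℤ) →
                sumℤ p (λ i → g ((i ℕ.+ r) % p)) ≡ sumℤ p g
  sumℤ-rotate p r r≤p g = begin
    sumℤ p F                                           ≡⟨ cong (λ k → sumℤ k F) (ℕ.m∸n+n≡m r≤p) ⟨
    sumℤ (p ∸ r ℕ.+ r) F                               ≡⟨ sumℤ-split (p ∸ r) r F ⟩
    sumℤ (p ∸ r) F + sumℤ r (λ i → F (p ∸ r ℕ.+ i))    ≡⟨ cong₂ _+_ (sumℤ-cong (p ∸ r) head) (sumℤ-cong r tail) ⟩
    sumℤ (p ∸ r) (λ i → g (r ℕ.+ i)) + sumℤ r g        ≡⟨ ℤ.+-comm _ (sumℤ r g) ⟩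
    sumℤ r g + sumℤ (p ∸ r) (λ i → g (r ℕ.+ i))        ≡⟨ sumℤ-split r (p ∸ r) g ⟨
    sumℤ (r ℕ.+ (p ∸ r)) g                             ≡⟨ cong (λ k → sumℤ k g) (ℕ.m+[n∸m]≡n r≤p) ⟩
    sumℤ p g                                           ∎
    where
    open ≡-Reasoning
    F = λ i → g ((i ℕ.+ r) % p)
    head : ∀ i → i < p ∸ r → F i ≡ g (r ℕ.+ i)
    head i i<p∸r = cong g (trans (m<n⇒m%n≡m (subst (i ℕ.+ r <_) (ℕ.m∸n+n≡m r≤p) (ℕ.+-monoˡ-< r i<p∸r)))
                                 (ℕ.+-comm i r))
    tail : ∀ i → i < r → F (p ∸ r ℕ.+ i) ≡ g i
    tail i i<r = cong g (begin
      (p ∸ r ℕ.+ i ℕ.+ r) % p  ≡⟨ cong (_% p) (trans (swap (p ∸ r) i r) (cong (i ℕ.+_) (ℕ.m∸n+n≡m r≤p))) ⟩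
      (i ℕ.+ p) % p            ≡⟨ [m+n]%n≡m%n i p ⟩
      i % p                    ≡⟨ m<n⇒m%n≡m (ℕ.<-≤-trans i<r r≤p) ⟩
      i                        ∎)
      where
      swap : ∀ a i r → a ℕ.+ i ℕ.+ r ≡ i ℕ.+ (a ℕ.+ r)
      swap = ℕ-Solver.solve-∀

open RangeSums

module Modular where

  open import Data.Nat using (_<_)
  open import Data.Nat.Coprimality using (prime⇒coprime; coprime-Bézout)
  open import Data.Nat.DivMod using (_%_; m*n%n≡0; m<n⇒m%n≡m; %-distribˡ-*; m%n%n≡m%n; [m+kn]%n≡m%n; %-pred-≡0; m%n<n)
  open import Data.Nat.GCD using (module Bézout)
  open import Data.Nat.Primality using (Prime)

  [m*[n%d]]%d≡[m*n]%d : ∀ m n d .{{_ : ℕ.NonZero d}} → (m ℕ.* (n % d)) % d ≡ (m ℕ.* n) % d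
  [m*[n%d]]%d≡[m*n]%d m n d = begin
    (m ℕ.* (n % d)) % d              ≡⟨ %-distribˡ-* m (n % d) d ⟩
    ((m % d) ℕ.* (n % d % d)) % d    ≡⟨ cong (λ k → ((m % d) ℕ.* k) % d) (m%n%n≡m%n n d) ⟩
    ((m % d) ℕ.* (n % d)) % d        ≡⟨ %-distribˡ-* m n d ⟨
    (m ℕ.* n) % d                    ∎
    where open ≡-Reasoning

  module _ {m : ℕ} (isPrime : Prime (suc (suc m))) where

    private
      p = suc (suc m)

    %-pseudoInverse : ∀ i → 0 < i → i < p → ∃[ y ] (i ℕ.* y) % p ≡ 1
    %-pseudoInverse (suc i) _ i<p with coprime-Bézout (prime⇒coprime isPrime i<p)
    ... | Bézout.-+ x y 1+xp≡yi = y , (begin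
      (suc i ℕ.* y) % p  ≡⟨ cong (_% p) (trans (ℕ.*-comm (suc i) y) (sym 1+xp≡yi)) ⟩
      (1 ℕ.+ x ℕ.* p) % p ≡⟨ [m+kn]%n≡m%n 1 x p ⟩
      1                  ∎)
      where open ≡-Reasoning
    ... | Bézout.+- x y 1+yi≡xp = suc m ℕ.* y , (begin
      (suc i ℕ.* (suc m ℕ.* y)) % p         ≡⟨ cong (_% p) reassoc ⟩
      (suc m ℕ.* (y ℕ.* suc i)) % p         ≡⟨ [m*[n%d]]%d≡[m*n]%d (suc m) (y ℕ.* suc i) p ⟨
      (suc m ℕ.* ((y ℕ.* suc i) % p)) % p   ≡⟨ cong (λ k → (suc m ℕ.* k) % p) yi≡-1 ⟩
      (suc m ℕ.* suc m) % p                 ≡⟨ cong (_% p) square ⟩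
      (1 ℕ.+ m ℕ.* p) % p                   ≡⟨ [m+kn]%n≡m%n 1 m p ⟩
      1                                     ∎)
      where
      open ≡-Reasoning
      reassoc : suc i ℕ.* (suc m ℕ.* y) ≡ suc m ℕ.* (y ℕ.* suc i)
      reassoc = ℕ-Solver.solve (i ∷ m ∷ y ∷ [])
      square : suc m ℕ.* suc m ≡ 1 ℕ.+ m ℕ.* suc (suc m)
      square = ℕ-Solver.solve (m ∷ [])
      yi≡-1 : (y ℕ.* suc i) % p ≡ suc m
      yi≡-1 = %-pred-≡0 {y ℕ.* suc i} {p} (trans (cong (_% p) 1+yi≡xp) (m*n%n≡0 x p))

    %-inverse : ∀ i → 0 < i → i < p → ∃[ t ] (0 < t × t < p × (i ℕ.* t) % p ≡ 1)
    %-inverse i 0<i i<p with %-pseudoInverse i 0<i i<p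
    ... | y , iy≡1 = y % p , ℕ.n≢0⇒n>0 t≢0 , m%n<n y p , it≡1
      where
      open ≡-Reasoning
      it≡1 : (i ℕ.* (y % p)) % p ≡ 1
      it≡1 = trans ([m*[n%d]]%d≡[m*n]%d i y p) iy≡1
      t≢0 : y % p ≢ 0
      t≢0 t≡0 = ℕ.0≢1+n (begin
        0                        ≡⟨ cong (_% p) (ℕ.*-zeroʳ i) ⟨
        (i ℕ.* 0) % p            ≡⟨ cong (λ k → (i ℕ.* k) % p) t≡0 ⟨
        (i ℕ.* (y % p)) % p      ≡⟨ it≡1 ⟩
        1                        ∎)

    *-cancelˡ-% : ∀ c {a b} → 0 < c → c < p → a < p → b < p → (c ℕ.* a) % p ≡ (c ℕ.* b) % p → a ≡ b
    *-cancelˡ-% c {a} {b} 0<c c<p a<p b<p ca≡cb with %-inverse c 0<c c<p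
    ... | v , _ , _ , cv≡1 = trans (sym (undo a<p)) (trans (cong (λ k → (v ℕ.* k) % p) ca≡cb) (undo b<p))
      where
      reorder : ∀ v c x → v ℕ.* (c ℕ.* x) ≡ x ℕ.* (c ℕ.* v)
      reorder = ℕ-Solver.solve-∀
      undo : ∀ {x} → x < p → (v ℕ.* ((c ℕ.* x) % p)) % p ≡ x
      undo {x} x<p = begin
        (v ℕ.* ((c ℕ.* x) % p)) % p  ≡⟨ [m*[n%d]]%d≡[m*n]%d v (c ℕ.* x) p ⟩
        (v ℕ.* (c ℕ.* x)) % p        ≡⟨ cong (_% p) (reorder v c x) ⟩
        (x ℕ.* (c ℕ.* v)) % p        ≡⟨ [m*[n%d]]%d≡[m*n]%d x (c ℕ.* v) p ⟨
        (x ℕ.* ((c ℕ.* v) % p)) % p  ≡⟨ cong (λ k → (x ℕ.* k) % p) cv≡1 ⟩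
        (x ℕ.* 1) % p                ≡⟨ cong (_% p) (ℕ.*-identityʳ x) ⟩
        x % p                        ≡⟨ m<n⇒m%n≡m x<p ⟩
        x                            ∎
        where open ≡-Reasoning

open Modular

module Trace where

  open import Data.Integer using (+_; _+_; _*_; _-_)
  open import Data.Nat using (_∸_; _<_; _≡ᵇ_)
  open import Data.Nat.DivMod using (_%_; m<n⇒m%n≡m)
  open import Data.Nat.Primality using (Prime)

  if-≡ᵇ-yes : ∀ {a b} {A : Set} {x y : A} → a ≡ b → (if a ≡ᵇ b then x else y) ≡ x
  if-≡ᵇ-yes {a} {b} a≡b with a ≡ᵇ b | ℕ.≡⇒≡ᵇ a b a≡b
  ... | true | _ = refl

  if-≡ᵇ-no : ∀ {a b} {A : Set} {x y : A} → a ≢ b → (if a ≡ᵇ b then x else y) ≡ y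
  if-≡ᵇ-no {a} {b} a≢b with a ≡ᵇ b | ℕ.≡ᵇ⇒≡ a b
  ... | true  | a≡b = ⊥-elim (a≢b (a≡b _))
  ... | false | _   = refl

  module _ {m : ℕ} (isPrime : Prime (suc (suc m))) where

    private
      p = suc (suc m)
      n = suc m

    σ-coeff₀ : ∀ t → 0 < t → t < p → (h : Elt) → σ p t h 0 ≡ h 0
    σ-coeff₀ t 0<t t<p h = sumℤ-δ p 0 (s≤s z≤n) (λ i i<p i≢0 → if-≡ᵇ-no (i≢0 ∘ it≡0⇒i≡0 i<p))
      where
      it≡0⇒i≡0 : ∀ {i} → i < p → (i ℕ.* t) % p ≡ 0 → i ≡ 0
      it≡0⇒i≡0 {i} i<p it≡0 = *-cancelˡ-% isPrime t 0<t t<p i<p (s≤s z≤n)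
        (trans (cong (_% p) (ℕ.*-comm t i)) (trans it≡0 (cong (_% p) (sym (ℕ.*-zeroʳ t)))))

    TrElt-coeff₀ : (h : Elt) → TrElt p h 0 ≡ + n * h 0
    TrElt-coeff₀ h = trans (sumℤ-cong n (λ t t<n → σ-coeff₀ (suc t) (s≤s z≤n) (s≤s t<n) h)) (sumℤ-const n (h 0))

    TrElt-coeff₁ : (h : Elt) → TrElt p h 1 ≡ sumℤ n (h ∘ suc)
    TrElt-coeff₁ h = begin
      sumℤ n (λ t → sumℤ p (λ i → F i t))                           ≡⟨ sumℤ-comm n p (λ t i → F i t) ⟩
      sumℤ p (λ i → sumℤ n (F i))                                   ≡⟨ sumℤ-suc n (λ i → sumℤ n (F i)) ⟩
      sumℤ n (F 0) + sumℤ n (λ i → sumℤ n (F (suc i)))              ≡⟨ cong₂ _+_ (sumℤ-zero n (λ _ _ → refl))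
                                                                                (sumℤ-cong n (λ i → picks (suc i) (s≤s z≤n) ∘ s≤s)) ⟩
      + 0 + sumℤ n (h ∘ suc)                                        ≡⟨ ℤ.+-identityˡ _ ⟩
      sumℤ n (h ∘ suc)                                              ∎
      where
      open ≡-Reasoning
      F : ℕ → ℕ → ℤ
      F i t = if (i ℕ.* suc t) % p ≡ᵇ 1 then h i else + 0
      picks : ∀ i → 0 < i → i < p → sumℤ n (F i) ≡ h i
      picks i 0<i i<p with %-inverse isPrime i 0<i i<p
      ... | suc t₀ , _ , s≤s t₀<n , it₀≡1 = trans (sumℤ-δ n t₀ t₀<n (λ t t<n t≢t₀ → if-≡ᵇ-no (t≢t₀ ∘ unique t<n)))
                                                  (if-≡ᵇ-yes it₀≡1)
        where
        unique : ∀ {t} → t < n → (i ℕ.* suc t) % p ≡ 1 → t ≡ t₀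
        unique t<n it≡1 = ℕ.suc-injective (*-cancelˡ-% isPrime i 0<i i<p (s≤s t<n) (s≤s t₀<n) (trans it≡1 (sym it₀≡1)))

    Tr-formula : (h : Elt) → Tr p h ≡ + n * h 0 - sumℤ n (h ∘ suc)
    Tr-formula h = cong₂ _-_ (TrElt-coeff₀ h) (TrElt-coeff₁ h)

    ψ-formula : (g : Elt) → ∀ k → k < n → ψ p g (suc k) ≡ + p * g (n ∸ k) - sumℤ p g
    ψ-formula g k k<n = begin
      Tr p h                                     ≡⟨ Tr-formula h ⟩
      + n * h 0 - sumℤ n (h ∘ suc)               ≡⟨ cong (λ s → + n * h 0 - s) tail ⟩
      + n * h 0 - (sumℤ p g - h 0)               ≡⟨ cong (λ x → + n * x - (sumℤ p g - x)) h₀ ⟩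
      + n * g (n ∸ k) - (sumℤ p g - g (n ∸ k))   ≡⟨ collect (+ n) (g (n ∸ k)) (sumℤ p g) ⟩
      + p * g (n ∸ k) - sumℤ p g                 ∎
      where
      open ≡-Reasoning
      h = mulω^ p (suc k) g
      shift : ∀ j → h j ≡ g ((j ℕ.+ (n ∸ k)) % p)
      shift j = cong (λ r → g ((j ℕ.+ (p ∸ r)) % p)) (m<n⇒m%n≡m (s≤s k<n))
      h₀ : h 0 ≡ g (n ∸ k)
      h₀ = trans (shift 0) (cong g (m<n⇒m%n≡m (s≤s (ℕ.m∸n≤m n k))))
      cancel : ∀ a s → s ≡ a + s - a
      cancel = ℤ-Solver.solve-∀
      tail : sumℤ n (h ∘ suc) ≡ sumℤ p g - h 0
      tail = begin
        sumℤ n (h ∘ suc)              ≡⟨ cancel (h 0) _ ⟩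
        h 0 + sumℤ n (h ∘ suc) - h 0  ≡⟨ cong (_- h 0) (sumℤ-suc n h) ⟨
        sumℤ p h - h 0                ≡⟨ cong (_- h 0) (sumℤ-cong p (λ j _ → shift j)) ⟩
        sumℤ p (λ j → g ((j ℕ.+ (n ∸ k)) % p)) - h 0
                                      ≡⟨ cong (_- h 0) (sumℤ-rotate p (n ∸ k) (ℕ.≤-trans (ℕ.m∸n≤m n k) (ℕ.n≤1+n n)) g) ⟩
        sumℤ p g - h 0                ∎
      collect : ∀ k x s → k * x - (s - x) ≡ (+ 1 + k) * x - s
      collect = ℤ-Solver.solve-∀

    normSq-formula : (g : Elt) → g 0 ≡ + 0 →
      normSq p g ≡ + p * + p * sumℤ n (λ k → g (suc k) * g (suc k)) - (+ p + + 1) * sumℤ n (g ∘ suc) * sumℤ n (g ∘ suc)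
    normSq-formula g g₀≡0 = begin
      sumℤ n (λ k → ψ p g (suc k) * ψ p g (suc k))
        ≡⟨ sumℤ-cong n (λ k k<n → cong₂ _*_ (ψ-formula g k k<n) (ψ-formula g k k<n)) ⟩
      sumℤ n (λ k → (+ p * g (n ∸ k) - sumℤ p g) * (+ p * g (n ∸ k) - sumℤ p g))
        ≡⟨ sumℤ-reverse n (λ j → (+ p * g j - sumℤ p g) * (+ p * g j - sumℤ p g)) ⟩
      sumℤ n (λ k → (+ p * g (suc k) - sumℤ p g) * (+ p * g (suc k) - sumℤ p g))
        ≡⟨ sumℤ-[af-b]² n (+ p) (sumℤ p g) (g ∘ suc) ⟩
      + p * + p * G₂ - + 2 * + p * sumℤ p g * S + + n * (sumℤ p g * sumℤ p g)
        ≡⟨ cong (λ s → + p * + p * G₂ - + 2 * + p * s * S + + n * (s * s)) Sₚ≡S ⟩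
      + p * + p * G₂ - + 2 * + p * S * S + + n * (S * S)
        ≡⟨ collect G₂ S (+ n) ⟩
      + p * + p * G₂ - (+ p + + 1) * S * S
        ∎
      where
      open ≡-Reasoning
      S  = sumℤ n (g ∘ suc)
      G₂ = sumℤ n (λ k → g (suc k) * g (suc k))
      Sₚ≡S : sumℤ p g ≡ S
      Sₚ≡S = trans (sumℤ-suc n g) (trans (cong (_+ S) g₀≡0) (ℤ.+-identityˡ S))
      collect : ∀ g₂ s k → (+ 1 + k) * (+ 1 + k) * g₂ - + 2 * (+ 1 + k) * s * s + k * (s * s)
                         ≡ (+ 1 + k) * (+ 1 + k) * g₂ - ((+ 1 + k) + + 1) * s * s
      collect = ℤ-Solver.solve-∀

open Trace

module Distances where

  open import Data.Fin using (Fin; fromℕ<)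
  open import Data.Integer using (+_; _+_; _*_; _-_; -_)
  open import Data.Nat using (_∸_; _<_; _<?_)
  open import Data.Nat.Primality using (Prime)
  open import Data.Vec using ([]; _∷_)

  -- Signs are encoded as false = −1, true = +1; then τ a b = (b − a)/2 and χ a b = −ab.
  τ : Bool → Bool → ℤ
  τ false true  = + 1
  τ true  false = - + 1
  τ _     _     = + 0

  χ : Bool → Bool → ℤ
  χ false true  = + 1
  χ true  false = + 1
  χ _     _     = - + 1

  zipSum : {k : ℕ} → (Bool → Bool → ℤ) → Vec Bool k → Vec Bool k → ℤ
  zipSum F []      []      = + 0
  zipSum F (a ∷ x) (b ∷ y) = F a b + zipSum F x y

  zipSum-*ˡ : {k : ℕ} (c : ℤ) (F : Bool → Bool → ℤ) (x y : Vec Bool k) →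
              zipSum (λ a b → c * F a b) x y ≡ c * zipSum F x y
  zipSum-*ˡ c F []      []      = sym (ℤ.*-zeroʳ c)
  zipSum-*ˡ c F (a ∷ x) (b ∷ y) = trans (cong (λ s → c * F a b + s) (zipSum-*ˡ c F x y)) (sym (ℤ.*-distribˡ-+ c (F a b) _))

  sumℤ-zipSum : (k : ℕ) (F : Bool → Bool → ℤ) (x y : Vec Bool k) (h : ℕ → ℤ) →
                (∀ i (i<k : i < k) → h i ≡ F (lookup x (fromℕ< i<k)) (lookup y (fromℕ< i<k))) →
                sumℤ k h ≡ zipSum F x y
  sumℤ-zipSum zero    F []      []      h h≡F = refl
  sumℤ-zipSum (suc k) F (a ∷ x) (b ∷ y) h h≡F =
    trans (sumℤ-suc k h) (cong₂ _+_ (h≡F 0 (s≤s z≤n)) (sumℤ-zipSum k F x y (h ∘ suc) (λ i → h≡F (suc i) ∘ s≤s)))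

  Στ : {k : ℕ} → Vec Bool k → Vec Bool k → ℤ
  Στ = zipSum τ

  hamming : {k : ℕ} → Vec Bool k → Vec Bool k → ℤ
  hamming = zipSum (λ a b → τ a b * τ a b)

  Σχ : {k : ℕ} → Vec Bool k → Vec Bool k → ℤ
  Σχ = zipSum χ

  Σχ≡2hamming-k : {k : ℕ} (x y : Vec Bool k) → Σχ x y ≡ + 2 * hamming x y - + k
  Σχ≡2hamming-k []      []      = refl
  Σχ≡2hamming-k {suc k} (a ∷ x) (b ∷ y) = trans (cong (λ s → χ a b + s) (Σχ≡2hamming-k x y)) (step a b (hamming x y) (+ k))
    where
    step : ∀ a b h k → χ a b + (+ 2 * h - k) ≡ + 2 * (τ a b * τ a b + h) - (+ 1 + k)
    step false false = ℤ-Solver.solve-∀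
    step false true  = ℤ-Solver.solve-∀
    step true  false = ℤ-Solver.solve-∀
    step true  true  = ℤ-Solver.solve-∀

  signToℤ-diff : (N : ℕ) (a b : Bool) → signToℤ N b - signToℤ N a ≡ + 2 * + N * τ a b
  signToℤ-diff N false false = lemma (+ N)
    where
    lemma : ∀ z → - z - - z ≡ + 2 * z * + 0
    lemma = ℤ-Solver.solve-∀
  signToℤ-diff N false true  = lemma (+ N)
    where
    lemma : ∀ z → z - - z ≡ + 2 * z * + 1
    lemma = ℤ-Solver.solve-∀
  signToℤ-diff N true  false = lemma (+ N)
    where
    lemma : ∀ z → - z - z ≡ + 2 * z * - + 1
    lemma = ℤ-Solver.solve-∀
  signToℤ-diff N true  true  = lemma (+ N)
    where
    lemma : ∀ z → z - z ≡ + 2 * z * + 0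
    lemma = ℤ-Solver.solve-∀

  fromCoords-suc : (n : ℕ) (a : Fin n → ℤ) (i : ℕ) (i<n : i < n) → fromCoords (suc n) a (suc i) ≡ a (fromℕ< i<n)
  fromCoords-suc n a i i<n with i <? n
  ... | yes _   = refl
  ... | no  i≮n = ⊥-elim (i≮n i<n)

  𝔡Sq-denominator : (N p : ℕ) →
    + (4 ℕ.* N ℕ.* N ℕ.* p ℕ.* p ℕ.* (p ∸ 1)) ≡ (+ 2 * + N) * (+ 2 * + N) * (+ p * + p * + (p ∸ 1))
  𝔡Sq-denominator N p = begin
    + (4 ℕ.* N ℕ.* N ℕ.* p ℕ.* p ℕ.* n)
      ≡⟨ ℤ.pos-* (4 ℕ.* N ℕ.* N ℕ.* p ℕ.* p) n ⟩
    + (4 ℕ.* N ℕ.* N ℕ.* p ℕ.* p) * + n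
      ≡⟨ cong (_* + n) (ℤ.pos-* (4 ℕ.* N ℕ.* N ℕ.* p) p) ⟩
    + (4 ℕ.* N ℕ.* N ℕ.* p) * + p * + n
      ≡⟨ cong (λ z → z * + p * + n) (ℤ.pos-* (4 ℕ.* N ℕ.* N) p) ⟩
    + (4 ℕ.* N ℕ.* N) * + p * + p * + n
      ≡⟨ cong (λ z → z * + p * + p * + n) (trans (ℤ.pos-* (4 ℕ.* N) N) (cong (_* + N) (ℤ.pos-* 4 N))) ⟩
    + 4 * + N * + N * + p * + p * + n
      ≡⟨ regroup (+ N) (+ p) (+ n) ⟩
    (+ 2 * + N) * (+ 2 * + N) * (+ p * + p * + n)
      ∎
    where
    open ≡-Reasoning
    n = p ∸ 1
    regroup : ∀ N p n → + 4 * N * N * p * p * n ≡ + 2 * N * (+ 2 * N) * (p * p * n)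
    regroup = ℤ-Solver.solve-∀

  module _ {m : ℕ} (isPrime : Prime (suc (suc m))) (N : ℕ) where

    private
      p = suc (suc m)
      n = suc m
      c = + 2 * + N

    distSq-elt : (x y : Vec Bool n) →
      distSq p (elt p N x) (elt p N y) ≡ c * c * (+ p * + p * hamming x y - (+ p + + 1) * Στ x y * Στ x y)
    distSq-elt x y = begin
      normSq p g                                                      ≡⟨ normSq-formula isPrime g refl ⟩
      + p * + p * G₂ - (+ p + + 1) * S * S                            ≡⟨ cong₂ (λ u v → + p * + p * u - (+ p + + 1) * v * v) G₂≡ S≡ ⟩
      + p * + p * (c * c * hamming x y) - (+ p + + 1) * (c * Στ x y) * (c * Στ x y)
                                                                      ≡⟨ factor (+ p) c (hamming x y) (Στ x y) ⟩
      c * c * (+ p * + p * hamming x y - (+ p + + 1) * Στ x y * Στ x y) ∎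
      where
      open ≡-Reasoning
      g = elt p N y −ᴱ elt p N x
      S  = sumℤ n (g ∘ suc)
      G₂ = sumℤ n (λ k → g (suc k) * g (suc k))
      coord : ∀ i (i<n : i < n) → g (suc i) ≡ c * τ (lookup x (fromℕ< i<n)) (lookup y (fromℕ< i<n))
      coord i i<n = trans (cong₂ _-_ (fromCoords-suc n _ i i<n) (fromCoords-suc n _ i i<n))
                          (signToℤ-diff N (lookup x (fromℕ< i<n)) (lookup y (fromℕ< i<n)))
      S≡ : S ≡ c * Στ x y
      S≡ = trans (sumℤ-zipSum n (λ a b → c * τ a b) x y (g ∘ suc) coord) (zipSum-*ˡ c τ x y)
      square : ∀ c t → (c * t) * (c * t) ≡ c * c * (t * t)
      square = ℤ-Solver.solve-∀
      G₂≡ : G₂ ≡ c * c * hamming x y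
      G₂≡ = trans (sumℤ-zipSum n (λ a b → c * c * (τ a b * τ a b)) x y _
                    (λ i i<n → trans (cong₂ _*_ (coord i i<n) (coord i i<n)) (square c _)))
                  (zipSum-*ˡ (c * c) (λ a b → τ a b * τ a b) x y)
      factor : ∀ p c h t → p * p * (c * c * h) - (p + + 1) * (c * t) * (c * t) ≡ c * c * (p * p * h - (p + + 1) * t * t)
      factor = ℤ-Solver.solve-∀

    twice-distSq-elt : (x y : Vec Bool n) →
      + 2 * distSq p (elt p N x) (elt p N y)
        ≡ c * c * (+ p * + p * (Σχ x y + + n) - + 2 * (+ p + + 1) * Στ x y * Στ x y)
    twice-distSq-elt x y = begin
      + 2 * distSq p (elt p N x) (elt p N y)
        ≡⟨ cong (+ 2 *_) (distSq-elt x y) ⟩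
      + 2 * (c * c * (+ p * + p * hamming x y - (+ p + + 1) * Στ x y * Στ x y))
        ≡⟨ double c (+ p) (hamming x y) (Στ x y) (+ n) ⟩
      c * c * (+ p * + p * (+ 2 * hamming x y - + n + + n) - + 2 * (+ p + + 1) * Στ x y * Στ x y)
        ≡⟨ cong (λ z → c * c * (+ p * + p * (z + + n) - + 2 * (+ p + + 1) * Στ x y * Στ x y))
                (Σχ≡2hamming-k x y) ⟨
      c * c * (+ p * + p * (Σχ x y + + n) - + 2 * (+ p + + 1) * Στ x y * Στ x y)
        ∎
      where
      open ≡-Reasoning
      double : ∀ c p h t k → + 2 * (c * c * (p * p * h - (p + + 1) * t * t))
                             ≡ c * c * (p * p * (+ 2 * h - k + k) - + 2 * (p + + 1) * t * t)
      double = ℤ-Solver.solve-∀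

open Distances

module SecondMoment where

  open import Algebra.Properties.CommutativeSemigroup ℤ.+-commutativeSemigroup using (interchange)
  open import Data.Integer using (+_; _+_; _*_; _-_; -_)
  open import Data.Vec using (_∷_)

  ∑ᶻ : List A → (A → ℤ) → ℤ
  ∑ᶻ []       f = + 0
  ∑ᶻ (x ∷ xs) f = f x + ∑ᶻ xs f

  ∑ᶻ-syntax : List A → (A → ℤ) → ℤ
  ∑ᶻ-syntax = ∑ᶻ

  infix 5 ∑ᶻ-syntax
  syntax ∑ᶻ-syntax xs (λ x → e) = ∑ᶻ[ x ∈ xs ] e

  ∑ᶻ-cong : (xs : List A) {f g : A → ℤ} → (∀ x → f x ≡ g x) → ∑ᶻ xs f ≡ ∑ᶻ xs g
  ∑ᶻ-cong []       f≡g = refl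
  ∑ᶻ-cong (x ∷ xs) f≡g = cong₂ _+_ (f≡g x) (∑ᶻ-cong xs f≡g)

  ∑ᶻ-+ : (xs : List A) (f g : A → ℤ) → ∑ᶻ[ x ∈ xs ] (f x + g x) ≡ ∑ᶻ xs f + ∑ᶻ xs g
  ∑ᶻ-+ []       f g = refl
  ∑ᶻ-+ (x ∷ xs) f g = trans (cong (λ s → f x + g x + s) (∑ᶻ-+ xs f g)) (interchange (f x) (g x) _ _)

  ∑ᶻ-*ˡ : (xs : List A) (c : ℤ) (f : A → ℤ) → ∑ᶻ[ x ∈ xs ] c * f x ≡ c * ∑ᶻ xs f
  ∑ᶻ-*ˡ []       c f = sym (ℤ.*-zeroʳ c)
  ∑ᶻ-*ˡ (x ∷ xs) c f = trans (cong (λ s → c * f x + s) (∑ᶻ-*ˡ xs c f)) (sym (ℤ.*-distribˡ-+ c (f x) _))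

  ∑ᶻ-const : (xs : List A) (c : ℤ) → ∑ᶻ xs (λ _ → c) ≡ + length xs * c
  ∑ᶻ-const []       c = sym (ℤ.*-zeroˡ c)
  ∑ᶻ-const (x ∷ xs) c = trans (cong (λ s → c + s) (∑ᶻ-const xs c)) (sym (ℤ.suc-* (+ length xs) c))

  ∑ᶻ-signVecs : (k : ℕ) (f : Vec Bool (suc k) → ℤ) →
                ∑ᶻ (signVecs (suc k)) f ≡ ∑ᶻ[ v ∈ signVecs k ] (f (false ∷ v) + f (true ∷ v))
  ∑ᶻ-signVecs k f = go (signVecs k)
    where
    go : (vs : List (Vec Bool k)) → ∑ᶻ (concatMap (λ v → (false ∷ v) ∷ (true ∷ v) ∷ []) vs) f
                                    ≡ ∑ᶻ[ v ∈ vs ] (f (false ∷ v) + f (true ∷ v))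
    go []       = refl
    go (v ∷ vs) = trans (cong (λ s → f (false ∷ v) + (f (true ∷ v) + s)) (go vs)) (sym (ℤ.+-assoc (f (false ∷ v)) (f (true ∷ v)) _))

  length-signVecs : (k : ℕ) → length (signVecs (suc k)) ≡ length (signVecs k) ℕ.+ length (signVecs k)
  length-signVecs k = go (signVecs k)
    where
    go : (vs : List (Vec Bool k)) → length (concatMap (λ v → (false ∷ v) ∷ (true ∷ v) ∷ []) vs) ≡ length vs ℕ.+ length vs
    go []       = refl
    go (v ∷ vs) = cong suc (trans (cong suc (go vs)) (sym (ℕ.+-suc (length vs) (length vs))))

  Q : {k : ℕ} → Vec Bool k → Vec Bool k → ℤ
  Q x y = Σχ x y * Σχ x y + Στ x y * Στ x y

  secondMoment : ℕ → ℤ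
  secondMoment k = ∑ᶻ[ x ∈ signVecs k ] ∑ᶻ[ y ∈ signVecs k ] Q x y

  private
    L : ℕ → ℤ
    L k = + length (signVecs k)

  Q-extensions : {k : ℕ} (x y : Vec Bool k) →
             Q (false ∷ x) (false ∷ y) + Q (false ∷ x) (true ∷ y) + (Q (true ∷ x) (false ∷ y) + Q (true ∷ x) (true ∷ y))
               ≡ + 6 + + 4 * Q x y
  Q-extensions x y = expand (Σχ x y) (Στ x y)
    where
    expand : ∀ s t → ((- + 1 + s) * (- + 1 + s) + (+ 0 + t) * (+ 0 + t)) + ((+ 1 + s) * (+ 1 + s) + (+ 1 + t) * (+ 1 + t))
                     + (((+ 1 + s) * (+ 1 + s) + (- + 1 + t) * (- + 1 + t)) + ((- + 1 + s) * (- + 1 + s) + (+ 0 + t) * (+ 0 + t)))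
                     ≡ + 6 + + 4 * (s * s + t * t)
    expand = ℤ-Solver.solve-∀

  secondMoment-suc : (k : ℕ) → secondMoment (suc k) ≡ + 6 * (L k * L k) + + 4 * secondMoment k
  secondMoment-suc k = begin
    ∑ᶻ[ x ∈ V′ ] ∑ᶻ[ y ∈ V′ ] Q x y
      ≡⟨ ∑ᶻ-signVecs k _ ⟩
    ∑ᶻ[ x ∈ V ] ((∑ᶻ[ y ∈ V′ ] Q (false ∷ x) y) + (∑ᶻ[ y ∈ V′ ] Q (true ∷ x) y))
      ≡⟨ ∑ᶻ-cong V (λ x → cong₂ _+_ (∑ᶻ-signVecs k _) (∑ᶻ-signVecs k _)) ⟩
    ∑ᶻ[ x ∈ V ] ((∑ᶻ[ y ∈ V ] (Q (false ∷ x) (false ∷ y) + Q (false ∷ x) (true ∷ y)))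
                + (∑ᶻ[ y ∈ V ] (Q (true ∷ x) (false ∷ y) + Q (true ∷ x) (true ∷ y))))
      ≡⟨ ∑ᶻ-cong V (λ x → trans (sym (∑ᶻ-+ V _ _)) (∑ᶻ-cong V (Q-extensions x))) ⟩
    ∑ᶻ[ x ∈ V ] ∑ᶻ[ y ∈ V ] (+ 6 + + 4 * Q x y)
      ≡⟨ ∑ᶻ-cong V (λ x → trans (∑ᶻ-+ V _ _) (cong₂ _+_ (∑ᶻ-const V (+ 6)) (∑ᶻ-*ˡ V (+ 4) _))) ⟩
    ∑ᶻ[ x ∈ V ] (L k * + 6 + + 4 * (∑ᶻ[ y ∈ V ] Q x y))
      ≡⟨ trans (∑ᶻ-+ V _ _) (cong₂ _+_ (∑ᶻ-const V _) (∑ᶻ-*ˡ V (+ 4) _)) ⟩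
    L k * (L k * + 6) + + 4 * secondMoment k
      ≡⟨ cong (_+ + 4 * secondMoment k) (reorder (L k)) ⟩
    + 6 * (L k * L k) + + 4 * secondMoment k
      ∎
    where
    open ≡-Reasoning
    V  = signVecs k
    V′ = signVecs (suc k)
    reorder : ∀ l → l * (l * + 6) ≡ + 6 * (l * l)
    reorder = ℤ-Solver.solve-∀

  secondMoment-formula : (k : ℕ) → + 2 * secondMoment k ≡ + 3 * + k * (+ length (signVecs k) * + length (signVecs k))
  secondMoment-formula zero    = refl
  secondMoment-formula (suc k) = begin
    + 2 * secondMoment (suc k)                            ≡⟨ cong (+ 2 *_) (secondMoment-suc k) ⟩
    + 2 * (+ 6 * (L k * L k) + + 4 * secondMoment k)      ≡⟨ regroup (L k) (secondMoment k) ⟩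
    + 12 * (L k * L k) + + 4 * (+ 2 * secondMoment k)     ≡⟨ cong (λ s → + 12 * (L k * L k) + + 4 * s) (secondMoment-formula k) ⟩
    + 12 * (L k * L k) + + 4 * (+ 3 * + k * (L k * L k))  ≡⟨ double (L k) (+ k) ⟩
    + 3 * (+ 1 + + k) * ((L k + L k) * (L k + L k))       ≡⟨ cong (λ l → + 3 * + suc k * (+ l * + l)) (length-signVecs k) ⟨
    + 3 * + suc k * (L (suc k) * L (suc k))               ∎
    where
    open ≡-Reasoning
    regroup : ∀ l s → + 2 * (+ 6 * (l * l) + + 4 * s) ≡ + 12 * (l * l) + + 4 * (+ 2 * s)
    regroup = ℤ-Solver.solve-∀
    double : ∀ l k → + 12 * (l * l) + + 4 * (+ 3 * k * (l * l)) ≡ + 3 * (+ 1 + k) * ((l + l) * (l + l))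
    double = ℤ-Solver.solve-∀

open SecondMoment

module RationalBounds where

  open import Data.Bool.Properties using (T-∨; T-∧)
  open import Data.Integer using (+_)
  open import Data.Rational using (ℚ; 0ℚ; 1ℚ; ½; _≤_; _<_; _+_; _*_; _-_; -_; _/_; toℚᵘ; nonNegative; positive)
  open import Data.Rational.Properties
  import Data.Rational.Unnormalised as ℚᵘ
  import Data.Rational.Unnormalised.Properties as ℚᵘ
  open import Data.Sum using (inj₁; inj₂)
  open import Level using (0ℓ)
  open import Relation.Nullary.Decidable using (dec⇒maybe)
  open import Tactic.RingSolver.Core.AlmostCommutativeRing using (AlmostCommutativeRing; fromCommutativeRing)

  ℚ-ring : AlmostCommutativeRing 0ℓ 0ℓ
  ℚ-ring = fromCommutativeRing +-*-commutativeRing (λ q → dec⇒maybe (0ℚ ≟ q))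

  toℚᵘ-toℚ : ∀ z → toℚᵘ (toℚ z) ℚᵘ.≃ ℚᵘ.mkℚᵘ z 0
  toℚᵘ-toℚ z = toℚᵘ-fromℚᵘ (ℚᵘ.mkℚᵘ z 0)

  toℚ-+ : ∀ a b → toℚ (a ℤ.+ b) ≡ toℚ a + toℚ b
  toℚ-+ a b = toℚᵘ-injective (begin
    toℚᵘ (toℚ (a ℤ.+ b))            ≈⟨ toℚᵘ-toℚ (a ℤ.+ b) ⟩
    ℚᵘ.mkℚᵘ (a ℤ.+ b) 0             ≈⟨ ℚᵘ.*≡* (cross a b) ⟩
    ℚᵘ.mkℚᵘ a 0 ℚᵘ.+ ℚᵘ.mkℚᵘ b 0    ≈⟨ ℚᵘ.+-cong (toℚᵘ-toℚ a) (toℚᵘ-toℚ b) ⟨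
    toℚᵘ (toℚ a) ℚᵘ.+ toℚᵘ (toℚ b)  ≈⟨ toℚᵘ-homo-+ (toℚ a) (toℚ b) ⟨
    toℚᵘ (toℚ a + toℚ b)            ∎)
    where
    open ℚᵘ.≃-Reasoning
    cross : ∀ a b → (a ℤ.+ b) ℤ.* + 1 ≡ (a ℤ.* + 1 ℤ.+ b ℤ.* + 1) ℤ.* + 1
    cross = ℤ-Solver.solve-∀

  toℚ-* : ∀ a b → toℚ (a ℤ.* b) ≡ toℚ a * toℚ b
  toℚ-* a b = toℚᵘ-injective (begin
    toℚᵘ (toℚ (a ℤ.* b))            ≈⟨ toℚᵘ-toℚ (a ℤ.* b) ⟩
    ℚᵘ.mkℚᵘ (a ℤ.* b) 0             ≈⟨ ℚᵘ.*≡* refl ⟩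
    ℚᵘ.mkℚᵘ a 0 ℚᵘ.* ℚᵘ.mkℚᵘ b 0    ≈⟨ ℚᵘ.*-cong (toℚᵘ-toℚ a) (toℚᵘ-toℚ b) ⟨
    toℚᵘ (toℚ a) ℚᵘ.* toℚᵘ (toℚ b)  ≈⟨ toℚᵘ-homo-* (toℚ a) (toℚ b) ⟨
    toℚᵘ (toℚ a * toℚ b)            ∎)
    where open ℚᵘ.≃-Reasoning

  toℚ-- : ∀ a b → toℚ (a ℤ.- b) ≡ toℚ a - toℚ b
  toℚ-- a b = toℚᵘ-injective (begin
    toℚᵘ (toℚ (a ℤ.- b))                 ≈⟨ toℚᵘ-toℚ (a ℤ.- b) ⟩
    ℚᵘ.mkℚᵘ (a ℤ.- b) 0                  ≈⟨ ℚᵘ.*≡* (cross a b) ⟩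
    ℚᵘ.mkℚᵘ a 0 ℚᵘ.- ℚᵘ.mkℚᵘ b 0         ≈⟨ ℚᵘ.+-cong (toℚᵘ-toℚ a) (ℚᵘ.-‿cong (toℚᵘ-toℚ b)) ⟨
    toℚᵘ (toℚ a) ℚᵘ.- toℚᵘ (toℚ b)       ≈⟨ ℚᵘ.+-congʳ (toℚᵘ (toℚ a)) (toℚᵘ-homo‿- (toℚ b)) ⟨
    toℚᵘ (toℚ a) ℚᵘ.+ toℚᵘ (- toℚ b)     ≈⟨ toℚᵘ-homo-+ (toℚ a) (- toℚ b) ⟨
    toℚᵘ (toℚ a - toℚ b)                 ∎)
    where
    open ℚᵘ.≃-Reasoning
    cross : ∀ a b → (a ℤ.- b) ℤ.* + 1 ≡ (a ℤ.* + 1 ℤ.+ ℤ.- b ℤ.* + 1) ℤ.* + 1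
    cross = ℤ-Solver.solve-∀

  toℚ-mono-≤ : ∀ {a b} → a ℤ.≤ b → toℚ a ≤ toℚ b
  toℚ-mono-≤ {a} {b} a≤b = toℚᵘ-cancel-≤
    (ℚᵘ.≤-respˡ-≃ (ℚᵘ.≃-sym (toℚᵘ-toℚ a)) (ℚᵘ.≤-respʳ-≃ (ℚᵘ.≃-sym (toℚᵘ-toℚ b))
      (ℚᵘ.*≤* (subst₂ ℤ._≤_ (sym (ℤ.*-identityʳ a)) (sym (ℤ.*-identityʳ b)) a≤b))))

  /-*-cancel : ∀ z k → (z / suc k) * ℕtoℚ (suc k) ≡ toℚ z
  /-*-cancel z k = toℚᵘ-injective (begin
    toℚᵘ ((z / suc k) * ℕtoℚ (suc k))                    ≈⟨ toℚᵘ-homo-* (z / suc k) (ℕtoℚ (suc k)) ⟩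
    toℚᵘ (z / suc k) ℚᵘ.* toℚᵘ (ℕtoℚ (suc k))            ≈⟨ ℚᵘ.*-cong (toℚᵘ-fromℚᵘ (ℚᵘ.mkℚᵘ z k)) (toℚᵘ-toℚ (+ suc k)) ⟩
    ℚᵘ.mkℚᵘ z k ℚᵘ.* ℚᵘ.mkℚᵘ (+ suc k) 0                ≈⟨ ℚᵘ.*≡* (cross z (+ suc k)) ⟩
    ℚᵘ.mkℚᵘ z 0                                          ≈⟨ toℚᵘ-toℚ z ⟨
    toℚᵘ (toℚ z)                                         ∎)
    where
    open ℚᵘ.≃-Reasoning
    cross : ∀ z s → (z ℤ.* s) ℤ.* + 1 ≡ z ℤ.* (s ℤ.* + 1)
    cross = ℤ-Solver.solve-∀

  ℕtoℚ-+ : ∀ a b → ℕtoℚ (a ℕ.+ b) ≡ ℕtoℚ a + ℕtoℚ b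
  ℕtoℚ-+ a b = toℚ-+ (+ a) (+ b)

  ℕtoℚ-* : ∀ a b → ℕtoℚ (a ℕ.* b) ≡ ℕtoℚ a * ℕtoℚ b
  ℕtoℚ-* a b = trans (cong toℚ (ℤ.pos-* a b)) (toℚ-* (+ a) (+ b))

  ℕtoℚ-mono-≤ : ∀ {a b} → a ℕ.≤ b → ℕtoℚ a ≤ ℕtoℚ b
  ℕtoℚ-mono-≤ a≤b = toℚ-mono-≤ (ℤ.+≤+ a≤b)

  0≤ℕtoℚ : ∀ k → 0ℚ ≤ ℕtoℚ k
  0≤ℕtoℚ k = ℕtoℚ-mono-≤ {0} {k} ℕ.z≤n

  *-nonNeg : ∀ {a b} → 0ℚ ≤ a → 0ℚ ≤ b → 0ℚ ≤ a * b
  *-nonNeg {a} {b} 0≤a 0≤b = subst (_≤ a * b) (*-zeroˡ b) (*-monoʳ-≤-nonNeg b {{nonNegative 0≤b}} 0≤a)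

  ≤⇒0≤- : ∀ {a b} → a ≤ b → 0ℚ ≤ b - a
  ≤⇒0≤- {a} {b} a≤b = subst (_≤ b - a) (+-inverseʳ a) (+-monoˡ-≤ (- a) a≤b)

  ≤-by-certificate : ∀ {a b} k c → 0ℚ < k → (b - a) * k ≡ c → 0ℚ ≤ c → a ≤ b
  ≤-by-certificate {a} {b} k c 0<k eq 0≤c = subst₂ _≤_ (+-identityˡ a) (cancel a b) (+-monoˡ-≤ a 0≤b-a)
    where
    0≤b-a : 0ℚ ≤ b - a
    0≤b-a = *-cancelʳ-≤-pos k {{positive 0<k}} (subst₂ _≤_ (sym (*-zeroˡ k)) (sym eq) 0≤c)
    cancel : ∀ a b → b - a + a ≡ b
    cancel = ℚ-Solver.solve-∀ ℚ-ring

  square-nonNeg : ∀ a → 0ℚ ≤ a * a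
  square-nonNeg a with ≤-total 0ℚ a
  ... | inj₁ 0≤a = *-nonNeg 0≤a 0≤a
  ... | inj₂ a≤0 = subst (0ℚ ≤_) (neg² a) (*-nonNeg 0≤-a 0≤-a)
    where
    0≤-a : 0ℚ ≤ - a
    0≤-a = neg-antimono-≤ a≤0
    neg² : ∀ a → - a * - a ≡ a * a
    neg² = ℚ-Solver.solve-∀ ℚ-ring

  *-pos : ∀ {a b} → 0ℚ < a → 0ℚ < b → 0ℚ < a * b
  *-pos {a} {b} 0<a 0<b = positive⁻¹ (a * b) {{pos*pos⇒pos a {{positive 0<a}} b {{positive 0<b}}}}

  *-cancelˡ-≡-pos : ∀ {a b} c → 0ℚ < c → c * a ≡ c * b → a ≡ b
  *-cancelˡ-≡-pos c 0<c ca≡cb =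
    ≤-antisym (*-cancelˡ-≤-pos c {{positive 0<c}} (≤-reflexive ca≡cb)) (*-cancelˡ-≤-pos c {{positive 0<c}} (≤-reflexive (sym ca≡cb)))

  square-mono-≤ : ∀ {a b} → 0ℚ ≤ a → a ≤ b → a * a ≤ b * b
  square-mono-≤ {a} {b} 0≤a a≤b = ≤-trans (*-monoˡ-≤-nonNeg a {{nonNegative 0≤a}} a≤b)
                                          (*-monoʳ-≤-nonNeg b {{nonNegative (≤-trans 0≤a a≤b)}} a≤b)

  square-≤⇒≤ : ∀ {a b} → 0ℚ ≤ b → a * a ≤ b * b → a ≤ b
  square-≤⇒≤ {a} {b} 0≤b a²≤b² with a ≤? b
  ... | yes a≤b = a≤b
  ... | no  a≰b = ⊥-elim (<-irrefl refl (<-≤-trans b²<a² a²≤b²))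
    where
    b<a : b < a
    b<a = ≰⇒> a≰b
    b²<a² : b * b < a * a
    b²<a² = ≤-<-trans (*-monoʳ-≤-nonNeg b {{nonNegative 0≤b}} (<⇒≤ b<a))
                      (*-monoʳ-<-pos a {{positive (≤-<-trans 0≤b b<a)}} b<a)

  0<ℕtoℚ-suc : ∀ k → 0ℚ < ℕtoℚ (suc k)
  0<ℕtoℚ-suc k = positive⁻¹ _ {{normalize-pos (suc k) 1}}

  sqrtLeᵇ-intro : ∀ {u v e} s → u - v - e * e ≤ s → 0ℚ ≤ s → s * s ≤ ℕtoℚ 4 * e * e * v → T (sqrtLeᵇ u v e)
  sqrtLeᵇ-intro {u} {v} {e} s w≤s 0≤s s²≤ with (u - v - e * e) ≤? 0ℚ
  ... | yes w≤0 = Equivalence.from T-∨ (inj₁ (≤⇒≤ᵇ w≤0))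
  ... | no  w≰0 = Equivalence.from T-∨ (inj₂ (≤⇒≤ᵇ (≤-trans (square-mono-≤ (<⇒≤ (≰⇒> w≰0)) w≤s) s²≤)))

  -- With s = ε in sqrtLeᵇ-intro both comparisons reduce to |u − ½| ≤ ε/4 and u ≥ ¼.
  sqrtCloseᵇ-½ : ∀ {ε u} → 0ℚ ≤ ε → ε ≤ 1ℚ → - ε ≤ ℕtoℚ 4 * u - ℕtoℚ 2 → ℕtoℚ 4 * u - ℕtoℚ 2 ≤ ε →
                 T (sqrtCloseᵇ u ½ ε)
  sqrtCloseᵇ-½ {ε} {u} 0≤ε ε≤1 lower upper = Equivalence.from (T-∧ {sqrtLeᵇ u ½ ε} {sqrtLeᵇ ½ u ε})
    (sqrtLeᵇ-intro {u} {½} {ε} ε gap₁ 0≤ε ε²≤2ε² , sqrtLeᵇ-intro {½} {u} {ε} ε gap₂ 0≤ε ε²≤4ε²u)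
    where
    0≤3ε+4ε² : 0ℚ ≤ ℕtoℚ 3 * ε + ℕtoℚ 4 * (ε * ε)
    0≤3ε+4ε² = +-mono-≤ (*-nonNeg (0≤ℕtoℚ 3) 0≤ε) (*-nonNeg (0≤ℕtoℚ 4) (square-nonNeg ε))
    gap₁ : u - ½ - ε * ε ≤ ε
    gap₁ = ≤-by-certificate (ℕtoℚ 4) _ (0<ℕtoℚ-suc 3) (eq ε u) (+-mono-≤ (≤⇒0≤- upper) 0≤3ε+4ε²)
      where
      eq : ∀ ε u → (ε - (u - ½ - ε * ε)) * ℕtoℚ 4 ≡ ε - (ℕtoℚ 4 * u - ℕtoℚ 2) + (ℕtoℚ 3 * ε + ℕtoℚ 4 * (ε * ε))
      eq = ℚ-Solver.solve-∀ ℚ-ring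
    gap₂ : ½ - u - ε * ε ≤ ε
    gap₂ = ≤-by-certificate (ℕtoℚ 4) _ (0<ℕtoℚ-suc 3) (eq ε u) (+-mono-≤ (≤⇒0≤- lower) 0≤3ε+4ε²)
      where
      eq : ∀ ε u → (ε - (½ - u - ε * ε)) * ℕtoℚ 4 ≡ ℕtoℚ 4 * u - ℕtoℚ 2 - - ε + (ℕtoℚ 3 * ε + ℕtoℚ 4 * (ε * ε))
      eq = ℚ-Solver.solve-∀ ℚ-ring
    ε²≤2ε² : ε * ε ≤ ℕtoℚ 4 * ε * ε * ½
    ε²≤2ε² = ≤-by-certificate 1ℚ _ (0<ℕtoℚ-suc 0) (eq ε) (square-nonNeg ε)
      where
      eq : ∀ ε → (ℕtoℚ 4 * ε * ε * ½ - ε * ε) * 1ℚ ≡ ε * ε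
      eq = ℚ-Solver.solve-∀ ℚ-ring
    ε²≤4ε²u : ε * ε ≤ ℕtoℚ 4 * ε * ε * u
    ε²≤4ε²u = ≤-by-certificate 1ℚ _ (0<ℕtoℚ-suc 0) (eq ε u)
                (*-nonNeg (square-nonNeg ε) (+-mono-≤ (≤⇒0≤- lower) (≤⇒0≤- ε≤1)))
      where
      eq : ∀ ε u → (ℕtoℚ 4 * ε * ε * u - ε * ε) * 1ℚ ≡ ε * ε * (ℕtoℚ 4 * u - ℕtoℚ 2 - - ε + (1ℚ - ε))
      eq = ℚ-Solver.solve-∀ ℚ-ring

  module _ {ε n x t u : ℚ} (0≤ε : 0ℚ ≤ ε) (ε≤1 : ε ≤ 1ℚ) (0<n : 0ℚ < n)
    (identity : ℕtoℚ 2 * u * ((n + 1ℚ) * (n + 1ℚ) * n)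
                ≡ (n + 1ℚ) * (n + 1ℚ) * (x + n) - ℕtoℚ 2 * (n + 1ℚ + 1ℚ) * t * t)
    (x-small : (ℕtoℚ 8 * x) * (ℕtoℚ 8 * x) ≤ (ε * n) * (ε * n))
    (t-small : (ℕtoℚ 8 * t) * (ℕtoℚ 8 * t) ≤ (ε * n) * (ε * n)) where

    private
      p = n + 1ℚ
      P = p * p * n
      0≤n = <⇒≤ 0<n
      0≤p : 0ℚ ≤ p
      0≤p = +-mono-≤ 0≤n (0≤ℕtoℚ 1)
      0≤εn : 0ℚ ≤ ε * n
      0≤εn = *-nonNeg 0≤ε 0≤n
      0<P : 0ℚ < P
      0<P = *-pos (*-pos 0<p 0<p) 0<n
        where
        0<p : 0ℚ < p
        0<p = <-≤-trans 0<n (subst (_≤ p) (+-identityʳ n) (+-monoʳ-≤ n (0≤ℕtoℚ 1)))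

      δP : (ℕtoℚ 4 * u - ℕtoℚ 2) * P ≡ ℕtoℚ 2 * (p * p) * x - ℕtoℚ 4 * (p + 1ℚ) * (t * t)
      δP = begin
        (ℕtoℚ 4 * u - ℕtoℚ 2) * P                                              ≡⟨ split u p n ⟩
        ℕtoℚ 2 * (ℕtoℚ 2 * u * P) - ℕtoℚ 2 * P                                 ≡⟨ cong (λ z → ℕtoℚ 2 * z - ℕtoℚ 2 * P) identity ⟩
        ℕtoℚ 2 * (p * p * (x + n) - ℕtoℚ 2 * (p + 1ℚ) * t * t) - ℕtoℚ 2 * P   ≡⟨ collect p n x t ⟩
        ℕtoℚ 2 * (p * p) * x - ℕtoℚ 4 * (p + 1ℚ) * (t * t)                     ∎
        where
        open ≡-Reasoning
        split : ∀ u p n → (ℕtoℚ 4 * u - ℕtoℚ 2) * (p * p * n) ≡ ℕtoℚ 2 * (ℕtoℚ 2 * u * (p * p * n)) - ℕtoℚ 2 * (p * p * n)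
        split = ℚ-Solver.solve-∀ ℚ-ring
        collect : ∀ p n x t → ℕtoℚ 2 * (p * p * (x + n) - ℕtoℚ 2 * (p + 1ℚ) * t * t) - ℕtoℚ 2 * (p * p * n)
                              ≡ ℕtoℚ 2 * (p * p) * x - ℕtoℚ 4 * (p + 1ℚ) * (t * t)
        collect = ℚ-Solver.solve-∀ ℚ-ring

    4u-2≤ε : ℕtoℚ 4 * u - ℕtoℚ 2 ≤ ε
    4u-2≤ε = ≤-by-certificate (ℕtoℚ 4 * P) _ (*-pos (0<ℕtoℚ-suc 3) 0<P) eq (+-mono-≤ (+-mono-≤ x-term ε-term) t-term)
      where
      open ≡-Reasoning
      x-term : 0ℚ ≤ p * p * (ε * n - ℕtoℚ 8 * x)
      x-term = *-nonNeg (*-nonNeg 0≤p 0≤p) (≤⇒0≤- (square-≤⇒≤ 0≤εn x-small))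
      ε-term : 0ℚ ≤ ℕtoℚ 3 * (ε * P)
      ε-term = *-nonNeg (0≤ℕtoℚ 3) (*-nonNeg 0≤ε (<⇒≤ 0<P))
      t-term : 0ℚ ≤ ℕtoℚ 16 * (p + 1ℚ) * (t * t)
      t-term = *-nonNeg (*-nonNeg (0≤ℕtoℚ 16) (+-mono-≤ 0≤p (0≤ℕtoℚ 1))) (square-nonNeg t)
      eq : (ε - (ℕtoℚ 4 * u - ℕtoℚ 2)) * (ℕtoℚ 4 * P)
           ≡ p * p * (ε * n - ℕtoℚ 8 * x) + ℕtoℚ 3 * (ε * P) + ℕtoℚ 16 * (p + 1ℚ) * (t * t)
      eq = begin
        (ε - (ℕtoℚ 4 * u - ℕtoℚ 2)) * (ℕtoℚ 4 * P)                       ≡⟨ distrib ε (ℕtoℚ 4 * u - ℕtoℚ 2) P ⟩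
        ℕtoℚ 4 * (ε * P) - ℕtoℚ 4 * ((ℕtoℚ 4 * u - ℕtoℚ 2) * P)          ≡⟨ cong (λ z → ℕtoℚ 4 * (ε * P) - ℕtoℚ 4 * z) δP ⟩
        ℕtoℚ 4 * (ε * P) - ℕtoℚ 4 * (ℕtoℚ 2 * (p * p) * x - ℕtoℚ 4 * (p + 1ℚ) * (t * t))
                                                                           ≡⟨ regroup ε p n x t ⟩
        p * p * (ε * n - ℕtoℚ 8 * x) + ℕtoℚ 3 * (ε * P) + ℕtoℚ 16 * (p + 1ℚ) * (t * t) ∎
        where
        distrib : ∀ ε δ P → (ε - δ) * (ℕtoℚ 4 * P) ≡ ℕtoℚ 4 * (ε * P) - ℕtoℚ 4 * (δ * P)
        distrib = ℚ-Solver.solve-∀ ℚ-ring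
        regroup : ∀ ε p n x t → ℕtoℚ 4 * (ε * (p * p * n)) - ℕtoℚ 4 * (ℕtoℚ 2 * (p * p) * x - ℕtoℚ 4 * (p + 1ℚ) * (t * t))
                                ≡ p * p * (ε * n - ℕtoℚ 8 * x) + ℕtoℚ 3 * (ε * (p * p * n)) + ℕtoℚ 16 * (p + 1ℚ) * (t * t)
        regroup = ℚ-Solver.solve-∀ ℚ-ring

    -- The t² term is absorbed using (p + 1)n < p²; the slack is 12p² − (p + 1)εn expanded at p = n + 1.
    -ε≤4u-2 : - ε ≤ ℕtoℚ 4 * u - ℕtoℚ 2
    -ε≤4u-2 = ≤-by-certificate (ℕtoℚ 16 * P) _ (*-pos (0<ℕtoℚ-suc 15) 0<P) eq (+-mono-≤ (+-mono-≤ x-term t-term) slack)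
      where
      open ≡-Reasoning
      0≤p+1 : 0ℚ ≤ p + 1ℚ
      0≤p+1 = +-mono-≤ 0≤p (0≤ℕtoℚ 1)
      x-term : 0ℚ ≤ ℕtoℚ 4 * (p * p) * (ε * n - - (ℕtoℚ 8 * x))
      x-term = *-nonNeg (*-nonNeg (0≤ℕtoℚ 4) (*-nonNeg 0≤p 0≤p)) (≤⇒0≤- -8x≤εn)
        where
        neg² : ∀ a → a * a ≡ - a * - a
        neg² = ℚ-Solver.solve-∀ ℚ-ring
        -8x≤εn : - (ℕtoℚ 8 * x) ≤ ε * n
        -8x≤εn = square-≤⇒≤ 0≤εn (subst (_≤ (ε * n) * (ε * n)) (neg² (ℕtoℚ 8 * x)) x-small)
      t-term : 0ℚ ≤ (p + 1ℚ) * ((ε * n) * (ε * n) - (ℕtoℚ 8 * t) * (ℕtoℚ 8 * t))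
      t-term = *-nonNeg 0≤p+1 (≤⇒0≤- t-small)
      slack : 0ℚ ≤ ε * n * ((p + 1ℚ) * n * (1ℚ - ε) + ℕtoℚ 11 * (n * n) + ℕtoℚ 22 * n + ℕtoℚ 12)
      slack = *-nonNeg 0≤εn (+-mono-≤ (+-mono-≤ (+-mono-≤ (*-nonNeg (*-nonNeg 0≤p+1 0≤n) (≤⇒0≤- ε≤1))
                                                         (*-nonNeg (0≤ℕtoℚ 11) (*-nonNeg 0≤n 0≤n)))
                                               (*-nonNeg (0≤ℕtoℚ 22) 0≤n))
                                     (0≤ℕtoℚ 12))
      eq : (ℕtoℚ 4 * u - ℕtoℚ 2 - - ε) * (ℕtoℚ 16 * P)
           ≡ ℕtoℚ 4 * (p * p) * (ε * n - - (ℕtoℚ 8 * x)) + (p + 1ℚ) * ((ε * n) * (ε * n) - (ℕtoℚ 8 * t) * (ℕtoℚ 8 * t))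
             + ε * n * ((p + 1ℚ) * n * (1ℚ - ε) + ℕtoℚ 11 * (n * n) + ℕtoℚ 22 * n + ℕtoℚ 12)
      eq = begin
        (ℕtoℚ 4 * u - ℕtoℚ 2 - - ε) * (ℕtoℚ 16 * P)                     ≡⟨ distrib (ℕtoℚ 4 * u - ℕtoℚ 2) ε P ⟩
        ℕtoℚ 16 * ((ℕtoℚ 4 * u - ℕtoℚ 2) * P) + ℕtoℚ 16 * (ε * P)         ≡⟨ cong (λ z → ℕtoℚ 16 * z + ℕtoℚ 16 * (ε * P)) δP ⟩
        ℕtoℚ 16 * (ℕtoℚ 2 * (p * p) * x - ℕtoℚ 4 * (p + 1ℚ) * (t * t)) + ℕtoℚ 16 * (ε * P)
                                                                            ≡⟨ regroup ε n x t ⟩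
        ℕtoℚ 4 * (p * p) * (ε * n - - (ℕtoℚ 8 * x)) + (p + 1ℚ) * ((ε * n) * (ε * n) - (ℕtoℚ 8 * t) * (ℕtoℚ 8 * t))
          + ε * n * ((p + 1ℚ) * n * (1ℚ - ε) + ℕtoℚ 11 * (n * n) + ℕtoℚ 22 * n + ℕtoℚ 12) ∎
        where
        distrib : ∀ δ ε P → (δ - - ε) * (ℕtoℚ 16 * P) ≡ ℕtoℚ 16 * (δ * P) + ℕtoℚ 16 * (ε * P)
        distrib = ℚ-Solver.solve-∀ ℚ-ring
        regroup : ∀ ε n x t →
          ℕtoℚ 16 * (ℕtoℚ 2 * ((n + 1ℚ) * (n + 1ℚ)) * x - ℕtoℚ 4 * (n + 1ℚ + 1ℚ) * (t * t)) + ℕtoℚ 16 * (ε * ((n + 1ℚ) * (n + 1ℚ) * n))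
          ≡ ℕtoℚ 4 * ((n + 1ℚ) * (n + 1ℚ)) * (ε * n - - (ℕtoℚ 8 * x))
            + (n + 1ℚ + 1ℚ) * ((ε * n) * (ε * n) - (ℕtoℚ 8 * t) * (ℕtoℚ 8 * t))
            + ε * n * ((n + 1ℚ + 1ℚ) * n * (1ℚ - ε) + ℕtoℚ 11 * (n * n) + ℕtoℚ 22 * n + ℕtoℚ 12)
        regroup = ℚ-Solver.solve-∀ ℚ-ring

  isFalse-*-≤ : (b : Bool) {a₁ a₂ c : ℚ} → 0ℚ ≤ a₁ → 0ℚ ≤ a₂ → (a₁ ≤ c → a₂ ≤ c → T b) →
                ℕtoℚ (isFalse b) * c ≤ a₁ + a₂
  isFalse-*-≤ true  {a₁} {a₂} {c} 0≤a₁ 0≤a₂ _ = subst (_≤ a₁ + a₂) (sym (*-zeroˡ c)) (+-mono-≤ 0≤a₁ 0≤a₂)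
  isFalse-*-≤ false {a₁} {a₂} {c} 0≤a₁ 0≤a₂ small⇒T with c ≤? a₁ + a₂
  ... | yes c≤a₁+a₂ = subst (_≤ a₁ + a₂) (sym (*-identityˡ c)) c≤a₁+a₂
  ... | no  c≰a₁+a₂ = ⊥-elim (small⇒T (≤-trans (a≤a+b 0≤a₂) (<⇒≤ sum<c))
                                       (≤-trans (subst (a₂ ≤_) (+-comm a₂ a₁) (a≤a+b 0≤a₁)) (<⇒≤ sum<c)))
    where
    sum<c : a₁ + a₂ < c
    sum<c = ≰⇒> c≰a₁+a₂
    a≤a+b : ∀ {a b} → 0ℚ ≤ b → a ≤ a + b
    a≤a+b {a} {b} 0≤b = subst (_≤ a + b) (+-identityʳ a) (+-monoʳ-≤ a 0≤b)

  ∑*c≤k*∑ᶻ : {A : Set} (xs : List A) (f : A → ℕ) (g : A → ℤ) (c k : ℚ) →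
            (∀ x → ℕtoℚ (f x) * c ≤ k * toℚ (g x)) → ℕtoℚ (∑ xs f) * c ≤ k * toℚ (∑ᶻ xs g)
  ∑*c≤k*∑ᶻ []       f g c k fc≤kg = subst₂ _≤_ (sym (*-zeroˡ c)) (sym (*-zeroʳ k)) ≤-refl
  ∑*c≤k*∑ᶻ (x ∷ xs) f g c k fc≤kg = subst₂ _≤_
    (sym (trans (cong (_* c) (ℕtoℚ-+ (f x) (∑ xs f))) (*-distribʳ-+ c (ℕtoℚ (f x)) _)))
    (sym (trans (cong (k *_) (toℚ-+ (g x) (∑ᶻ xs g))) (*-distribˡ-+ k (toℚ (g x)) _)))
    (+-mono-≤ (fc≤kg x) (∑*c≤k*∑ᶻ xs f g c k fc≤kg))

  [g+b]*[e-c]≤g*e : ∀ {G B e c} → B * e ≤ c * (G + B) → (G + B) * (e - c) ≤ G * e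
  [g+b]*[e-c]≤g*e {G} {B} {e} {c} Be≤cA = ≤-by-certificate 1ℚ _ (0<ℕtoℚ-suc 0) (eq G B e c) (≤⇒0≤- Be≤cA)
    where
    eq : ∀ G B e c → (G * e - (G + B) * (e - c)) * 1ℚ ≡ c * (G + B) - B * e
    eq = ℚ-Solver.solve-∀ ℚ-ring

open RationalBounds

module PairBounds where

  open import Data.Integer using (+_)
  open import Data.Nat using (_∸_)
  open import Data.Nat.Primality using (Prime)
  open import Data.Rational using (ℚ; 0ℚ; 1ℚ; _≤_; _<_; _+_; _*_; _-_)
  open import Data.Rational.Properties

  -- N = suc N₀ makes the denominator suc (D ∸ 1) of 𝔡Sq reduce to D = 4N²p²(p − 1).
  module _ {m : ℕ} (isPrime : Prime (suc (suc m))) (N₀ : ℕ) where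

    private
      p = suc (suc m)
      n = suc m
      N = suc N₀
      c = + 2 ℤ.* + N
      p≡n+1 : ℕtoℚ p ≡ ℕtoℚ n + 1ℚ
      p≡n+1 = trans (cong ℕtoℚ (ℕ.+-comm 1 n)) (ℕtoℚ-+ n 1)

    𝔡Sq-elt : (x y : Vec Bool n) →
      let u = 𝔡Sq p N (elt p N x) (elt p N y) in
      ℕtoℚ 2 * u * ((ℕtoℚ n + 1ℚ) * (ℕtoℚ n + 1ℚ) * ℕtoℚ n)
        ≡ (ℕtoℚ n + 1ℚ) * (ℕtoℚ n + 1ℚ) * (toℚ (Σχ x y) + ℕtoℚ n)
          - ℕtoℚ 2 * (ℕtoℚ n + 1ℚ + 1ℚ) * toℚ (Στ x y) * toℚ (Στ x y)
    𝔡Sq-elt x y = begin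
      ℕtoℚ 2 * u * ((ℕtoℚ n + 1ℚ) * (ℕtoℚ n + 1ℚ) * ℕtoℚ n)
        ≡⟨ cong (λ q → ℕtoℚ 2 * u * (q * q * ℕtoℚ n)) p≡n+1 ⟨
      ℕtoℚ 2 * u * (ℕtoℚ p * ℕtoℚ p * ℕtoℚ n)
        ≡⟨ cong (ℕtoℚ 2 * u *_) (trans (toℚ-* (+ p ℤ.* + p) (+ n)) (cong (_* ℕtoℚ n) (toℚ-* (+ p) (+ p)))) ⟨
      ℕtoℚ 2 * u * toℚ P
        ≡⟨ 2uP≡E ⟩
      toℚ E
        ≡⟨ toℚ-- Eχ Eτ ⟩
      toℚ Eχ - toℚ Eτ
        ≡⟨ cong₂ _-_ toℚEχ toℚEτ ⟩
      ℕtoℚ p * ℕtoℚ p * (toℚ (Σχ x y) + ℕtoℚ n) - ℕtoℚ 2 * (ℕtoℚ p + 1ℚ) * toℚ (Στ x y) * toℚ (Στ x y)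
        ≡⟨ cong (λ q → q * q * (toℚ (Σχ x y) + ℕtoℚ n) - ℕtoℚ 2 * (q + 1ℚ) * toℚ (Στ x y) * toℚ (Στ x y)) p≡n+1 ⟩
      (ℕtoℚ n + 1ℚ) * (ℕtoℚ n + 1ℚ) * (toℚ (Σχ x y) + ℕtoℚ n) - ℕtoℚ 2 * (ℕtoℚ n + 1ℚ + 1ℚ) * toℚ (Στ x y) * toℚ (Στ x y)
        ∎
      where
      open ≡-Reasoning
      u = 𝔡Sq p N (elt p N x) (elt p N y)
      d = distSq p (elt p N x) (elt p N y)
      D = 4 ℕ.* N ℕ.* N ℕ.* p ℕ.* p ℕ.* (p ∸ 1)
      P = + p ℤ.* + p ℤ.* + n
      Eχ = + p ℤ.* + p ℤ.* (Σχ x y ℤ.+ + n)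
      Eτ = + 2 ℤ.* (+ p ℤ.+ + 1) ℤ.* Στ x y ℤ.* Στ x y
      E = Eχ ℤ.- Eτ
      toℚEχ : toℚ Eχ ≡ ℕtoℚ p * ℕtoℚ p * (toℚ (Σχ x y) + ℕtoℚ n)
      toℚEχ = trans (toℚ-* (+ p ℤ.* + p) (Σχ x y ℤ.+ + n)) (cong₂ _*_ (toℚ-* (+ p) (+ p)) (toℚ-+ (Σχ x y) (+ n)))
      toℚEτ : toℚ Eτ ≡ ℕtoℚ 2 * (ℕtoℚ p + 1ℚ) * toℚ (Στ x y) * toℚ (Στ x y)
      toℚEτ = begin
        toℚ (+ 2 ℤ.* (+ p ℤ.+ + 1) ℤ.* Στ x y ℤ.* Στ x y)        ≡⟨ toℚ-* (+ 2 ℤ.* (+ p ℤ.+ + 1) ℤ.* Στ x y) (Στ x y) ⟩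
        toℚ (+ 2 ℤ.* (+ p ℤ.+ + 1) ℤ.* Στ x y) * toℚ (Στ x y)   ≡⟨ cong (_* toℚ (Στ x y)) (toℚ-* (+ 2 ℤ.* (+ p ℤ.+ + 1)) (Στ x y)) ⟩
        toℚ (+ 2 ℤ.* (+ p ℤ.+ + 1)) * toℚ (Στ x y) * toℚ (Στ x y)
          ≡⟨ cong (λ z → z * toℚ (Στ x y) * toℚ (Στ x y)) (trans (toℚ-* (+ 2) (+ p ℤ.+ + 1)) (cong (ℕtoℚ 2 *_) (toℚ-+ (+ p) (+ 1)))) ⟩
        ℕtoℚ 2 * (ℕtoℚ p + 1ℚ) * toℚ (Στ x y) * toℚ (Στ x y)     ∎
      0<c² : 0ℚ < toℚ (c ℤ.* c)
      0<c² = subst (0ℚ <_) (sym (trans (toℚ-* c c) (cong₂ _*_ (toℚ-* (+ 2) (+ N)) (toℚ-* (+ 2) (+ N)))))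
                   (*-pos 0<2N 0<2N)
        where
        0<2N : 0ℚ < ℕtoℚ 2 * ℕtoℚ N
        0<2N = *-pos (0<ℕtoℚ-suc 1) (0<ℕtoℚ-suc N₀)
      2uP≡E : ℕtoℚ 2 * u * toℚ P ≡ toℚ E
      2uP≡E = *-cancelˡ-≡-pos (toℚ (c ℤ.* c)) 0<c² (begin
        toℚ (c ℤ.* c) * (ℕtoℚ 2 * u * toℚ P)   ≡⟨ reorder (toℚ (c ℤ.* c)) u (toℚ P) ⟩
        ℕtoℚ 2 * (u * (toℚ (c ℤ.* c) * toℚ P)) ≡⟨ cong (λ z → ℕtoℚ 2 * (u * z)) (trans (cong toℚ (𝔡Sq-denominator N p))
                                                                                      (toℚ-* (c ℤ.* c) P)) ⟨
        ℕtoℚ 2 * (u * toℚ (+ D))               ≡⟨ cong (ℕtoℚ 2 *_) (/-*-cancel d (D ∸ 1)) ⟩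
        ℕtoℚ 2 * toℚ d                         ≡⟨ toℚ-* (+ 2) d ⟨
        toℚ (+ 2 ℤ.* d)                        ≡⟨ cong toℚ (twice-distSq-elt isPrime N x y) ⟩
        toℚ (c ℤ.* c ℤ.* E)                    ≡⟨ toℚ-* (c ℤ.* c) E ⟩
        toℚ (c ℤ.* c) * toℚ E                  ∎)
        where
        reorder : ∀ C u P → C * (ℕtoℚ 2 * u * P) ≡ ℕtoℚ 2 * (u * (C * P))
        reorder = ℚ-Solver.solve-∀ ℚ-ring

    module _ {ε : ℚ} (0≤ε : 0ℚ ≤ ε) (ε≤1 : ε ≤ 1ℚ) where

      private
        n̂ = ℕtoℚ n
        0<n̂ : 0ℚ < n̂
        0<n̂ = 0<ℕtoℚ-suc m

      𝔡Closeᵇ-elt : (x y : Vec Bool n) →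
        (ℕtoℚ 8 * toℚ (Σχ x y)) * (ℕtoℚ 8 * toℚ (Σχ x y)) ≤ (ε * n̂) * (ε * n̂) →
        (ℕtoℚ 8 * toℚ (Στ x y)) * (ℕtoℚ 8 * toℚ (Στ x y)) ≤ (ε * n̂) * (ε * n̂) →
        T (𝔡Closeᵇ p N ε (elt p N x) (elt p N y))
      𝔡Closeᵇ-elt x y χ-small τ-small = sqrtCloseᵇ-½ {ε} {u} 0≤ε ε≤1
        (-ε≤4u-2 {ε} {n̂} {toℚ (Σχ x y)} {toℚ (Στ x y)} {u} 0≤ε ε≤1 0<n̂ (𝔡Sq-elt x y) χ-small τ-small)
        (4u-2≤ε  {ε} {n̂} {toℚ (Σχ x y)} {toℚ (Στ x y)} {u} 0≤ε ε≤1 0<n̂ (𝔡Sq-elt x y) χ-small τ-small)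
        where u = 𝔡Sq p N (elt p N x) (elt p N y)

      isFalse-𝔡Closeᵇ-elt : (x y : Vec Bool n) →
        ℕtoℚ (isFalse (𝔡Closeᵇ p N ε (elt p N x) (elt p N y))) * ((ε * n̂) * (ε * n̂)) ≤ ℕtoℚ 64 * toℚ (Q x y)
      isFalse-𝔡Closeᵇ-elt x y =
        subst (ℕtoℚ (isFalse (𝔡Closeᵇ p N ε (elt p N x) (elt p N y))) * ((ε * n̂) * (ε * n̂)) ≤_) (sym 64Q)
          (isFalse-*-≤ (𝔡Closeᵇ p N ε (elt p N x) (elt p N y))
            (square-nonNeg (ℕtoℚ 8 * toℚ (Σχ x y))) (square-nonNeg (ℕtoℚ 8 * toℚ (Στ x y))) (𝔡Closeᵇ-elt x y))
        where
        64Q : ℕtoℚ 64 * toℚ (Q x y)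
            ≡ (ℕtoℚ 8 * toℚ (Σχ x y)) * (ℕtoℚ 8 * toℚ (Σχ x y)) + (ℕtoℚ 8 * toℚ (Στ x y)) * (ℕtoℚ 8 * toℚ (Στ x y))
        64Q = trans (cong (ℕtoℚ 64 *_) (trans (toℚ-+ (Σχ x y ℤ.* Σχ x y) (Στ x y ℤ.* Στ x y))
                                              (cong₂ _+_ (toℚ-* (Σχ x y) (Σχ x y)) (toℚ-* (Στ x y) (Στ x y)))))
                    (spread (toℚ (Σχ x y)) (toℚ (Στ x y)))
          where
          spread : ∀ a b → ℕtoℚ 64 * (a * a + b * b) ≡ (ℕtoℚ 8 * a) * (ℕtoℚ 8 * a) + (ℕtoℚ 8 * b) * (ℕtoℚ 8 * b)
          spread = ℚ-Solver.solve-∀ ℚ-ring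

      private
        Vs = signVecs n
        ŵ = ℕtoℚ (length Vs)

      badPairs-bound : ℕtoℚ (∑[ x ∈ Vs ] ∑[ y ∈ Vs ] isFalse (𝔡Closeᵇ p N ε (elt p N x) (elt p N y))) * (ε * ε * ℕtoℚ p)
                       ≤ ℕtoℚ 192 * (ŵ * ŵ)
      badPairs-bound = ≤-by-certificate n̂ _ 0<n̂ eq (+-mono-≤ (*-nonNeg (0≤ℕtoℚ 2) (≤⇒0≤- chebyshev)) slack)
        where
        open ≡-Reasoning
        b = ∑[ x ∈ Vs ] ∑[ y ∈ Vs ] isFalse (𝔡Closeᵇ p N ε (elt p N x) (elt p N y))
        b̂ = ℕtoℚ b
        sm = toℚ (secondMoment n)
        chebyshev : b̂ * ((ε * n̂) * (ε * n̂)) ≤ ℕtoℚ 64 * sm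
        chebyshev = ∑*c≤k*∑ᶻ Vs _ _ _ (ℕtoℚ 64) (λ x → ∑*c≤k*∑ᶻ Vs _ _ _ (ℕtoℚ 64) (isFalse-𝔡Closeᵇ-elt x))
        moment : ℕtoℚ 3 * n̂ * (ŵ * ŵ) ≡ ℕtoℚ 2 * sm
        moment = sym (begin
          ℕtoℚ 2 * sm                                      ≡⟨ toℚ-* (+ 2) (secondMoment n) ⟨
          toℚ (+ 2 ℤ.* secondMoment n)                     ≡⟨ cong toℚ (secondMoment-formula n) ⟩
          toℚ (+ 3 ℤ.* + n ℤ.* (+ length Vs ℤ.* + length Vs)) ≡⟨ toℚ-* (+ 3 ℤ.* + n) (+ length Vs ℤ.* + length Vs) ⟩
          toℚ (+ 3 ℤ.* + n) * toℚ (+ length Vs ℤ.* + length Vs) ≡⟨ cong₂ _*_ (toℚ-* (+ 3) (+ n)) (toℚ-* (+ length Vs) (+ length Vs)) ⟩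
          ℕtoℚ 3 * n̂ * (ŵ * ŵ)                             ∎)
        slack : 0ℚ ≤ b̂ * (ε * ε) * n̂ * (n̂ - ℕtoℚ 1)
        slack = *-nonNeg (*-nonNeg (*-nonNeg (0≤ℕtoℚ b) (square-nonNeg ε)) (<⇒≤ 0<n̂)) (≤⇒0≤- (ℕtoℚ-mono-≤ {1} {n} (s≤s z≤n)))
        eq : (ℕtoℚ 192 * (ŵ * ŵ) - b̂ * (ε * ε * ℕtoℚ p)) * n̂
             ≡ ℕtoℚ 2 * (ℕtoℚ 64 * sm - b̂ * ((ε * n̂) * (ε * n̂))) + b̂ * (ε * ε) * n̂ * (n̂ - ℕtoℚ 1)
        eq = begin
          (ℕtoℚ 192 * (ŵ * ŵ) - b̂ * (ε * ε * ℕtoℚ p)) * n̂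
            ≡⟨ cong (λ q → (ℕtoℚ 192 * (ŵ * ŵ) - b̂ * (ε * ε * q)) * n̂) p≡n+1 ⟩
          (ℕtoℚ 192 * (ŵ * ŵ) - b̂ * (ε * ε * (n̂ + 1ℚ))) * n̂
            ≡⟨ expand ŵ b̂ ε n̂ ⟩
          ℕtoℚ 2 * (ℕtoℚ 32 * (ℕtoℚ 3 * n̂ * (ŵ * ŵ)) - b̂ * ((ε * n̂) * (ε * n̂))) + b̂ * (ε * ε) * n̂ * (n̂ - ℕtoℚ 1)
            ≡⟨ cong (λ z → ℕtoℚ 2 * (ℕtoℚ 32 * z - b̂ * ((ε * n̂) * (ε * n̂))) + b̂ * (ε * ε) * n̂ * (n̂ - ℕtoℚ 1)) moment ⟩
          ℕtoℚ 2 * (ℕtoℚ 32 * (ℕtoℚ 2 * sm) - b̂ * ((ε * n̂) * (ε * n̂))) + b̂ * (ε * ε) * n̂ * (n̂ - ℕtoℚ 1)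
            ≡⟨ cong (λ z → ℕtoℚ 2 * (z - b̂ * ((ε * n̂) * (ε * n̂))) + b̂ * (ε * ε) * n̂ * (n̂ - ℕtoℚ 1)) (32·2 sm) ⟩
          ℕtoℚ 2 * (ℕtoℚ 64 * sm - b̂ * ((ε * n̂) * (ε * n̂))) + b̂ * (ε * ε) * n̂ * (n̂ - ℕtoℚ 1)
            ∎
          where
          expand : ∀ w b̂ ε n → (ℕtoℚ 192 * (w * w) - b̂ * (ε * ε * (n + 1ℚ))) * n
                               ≡ ℕtoℚ 2 * (ℕtoℚ 32 * (ℕtoℚ 3 * n * (w * w)) - b̂ * ((ε * n) * (ε * n))) + b̂ * (ε * ε) * n * (n - ℕtoℚ 1)
          expand = ℚ-Solver.solve-∀ ℚ-ring
          32·2 : ∀ s → ℕtoℚ 32 * (ℕtoℚ 2 * s) ≡ ℕtoℚ 64 * s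
          32·2 = ℚ-Solver.solve-∀ ℚ-ring

open PairBounds

module Counting where

  open import Data.List.Properties using (length-map)
  open import Data.Nat using (_^_)
  open import Data.Nat.Primality using (Prime)
  open import Data.Rational using (ℚ; 0ℚ; 1ℚ; _≤_; _+_; _*_; _-_; nonNegative)
  open import Data.Rational.Properties

  module _ {m : ℕ} (isPrime : Prime (suc (suc m))) (N₀ : ℕ) {ε : ℚ} (0≤ε : 0ℚ ≤ ε) (ε≤1 : ε ≤ 1ℚ) where

    private
      p = suc (suc m)
      n = suc m
      N = suc N₀
      Vs = signVecs n
      W = map (elt p N) Vs
      R = 𝔡Closeᵇ p N ε
      e = ε * ε * ℕtoℚ p

    count-bound : (K : ℕ) → let K₂ = suc (suc K) in
      ℕtoℚ (countAll p N K₂) * (e - ℕtoℚ 192 * ℕtoℚ K₂ * ℕtoℚ K₂) ≤ ℕtoℚ (countGood p N K₂ ε) * e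
    count-bound K = subst₂ (λ a g → ℕtoℚ a * (e - c) ≤ ℕtoℚ g * e) (sym all≡) (sym good≡)
      (subst (λ a → a * (e - c) ≤ ℕtoℚ G * e) (sym (ℕtoℚ-+ G Bt)) ([g+b]*[e-c]≤g*e {ℕtoℚ G} {ℕtoℚ Bt} {e} {c} bad-bound))
      where
      K₂ = suc (suc K)
      c = ℕtoℚ 192 * ℕtoℚ K₂ * ℕtoℚ K₂
      ts = tuples K₂ W
      G = length (filterᵇ (pairwiseᵇ R) ts)
      Bt = ∑[ t ∈ ts ] isFalse (pairwiseᵇ R t)
      all≡ : countAll p N K₂ ≡ G ℕ.+ Bt
      all≡ = trans (cong length (sym (tuples-map (elt p N) K₂ Vs))) (sym (length-filterᵇ+∑isFalse (pairwiseᵇ R) ts))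
      good≡ : countGood p N K₂ ε ≡ G
      good≡ = cong (λ vs → length (filterᵇ (pairwiseᵇ R) vs)) (sym (tuples-map (elt p N) K₂ Vs))
      bad-bound : ℕtoℚ Bt * e ≤ c * (ℕtoℚ G + ℕtoℚ Bt)
      bad-bound = begin
        ℕtoℚ Bt * e
          ≤⟨ *-monoʳ-≤-nonNeg e {{nonNegative 0≤e}} (ℕtoℚ-mono-≤ (∑-isFalse-pairwiseᵇ≤ R W K)) ⟩
        ℕtoℚ (K₂ ℕ.* K₂ ℕ.* (length W ^ K ℕ.* badPairs R W)) * e
          ≡⟨ cong (_* e) (trans (ℕtoℚ-* (K₂ ℕ.* K₂) (length W ^ K ℕ.* badPairs R W))
                                (cong₂ _*_ (ℕtoℚ-* K₂ K₂) (ℕtoℚ-* (length W ^ K) (badPairs R W)))) ⟩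
        ℕtoℚ K₂ * ℕtoℚ K₂ * (ℕtoℚ (length W ^ K) * ℕtoℚ (badPairs R W)) * e
          ≡⟨ cong₂ (λ l b → ℕtoℚ K₂ * ℕtoℚ K₂ * (ℕtoℚ (l ^ K) * ℕtoℚ b) * e) (length-map (elt p N) Vs) badPairs-W ⟩
        ℕtoℚ K₂ * ℕtoℚ K₂ * (ℕtoℚ (w ^ K) * ℕtoℚ b) * e
          ≡⟨ reassoc (ℕtoℚ K₂) (ℕtoℚ (w ^ K)) (ℕtoℚ b) e ⟩
        ℕtoℚ K₂ * ℕtoℚ K₂ * ℕtoℚ (w ^ K) * (ℕtoℚ b * e)
          ≤⟨ *-monoˡ-≤-nonNeg (ℕtoℚ K₂ * ℕtoℚ K₂ * ℕtoℚ (w ^ K)) {{nonNegative 0≤K²w^K}} (badPairs-bound isPrime N₀ 0≤ε ε≤1) ⟩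
        ℕtoℚ K₂ * ℕtoℚ K₂ * ℕtoℚ (w ^ K) * (ℕtoℚ 192 * (ℕtoℚ w * ℕtoℚ w))
          ≡⟨ regroup (ℕtoℚ K₂) (ℕtoℚ (w ^ K)) (ℕtoℚ w) ⟩
        c * (ℕtoℚ w * (ℕtoℚ w * ℕtoℚ (w ^ K)))
          ≡⟨ cong (c *_) (trans (ℕtoℚ-* w (w ℕ.* w ^ K)) (cong (ℕtoℚ w *_) (ℕtoℚ-* w (w ^ K)))) ⟨
        c * ℕtoℚ (w ^ K₂)
          ≡⟨ cong (λ a → c * ℕtoℚ a) (trans (sym (cong (_^ K₂) (length-map (elt p N) Vs))) (sym (length-tuples W K₂))) ⟩
        c * ℕtoℚ (length ts)
          ≡⟨ cong (λ a → c * ℕtoℚ a) (sym (length-filterᵇ+∑isFalse (pairwiseᵇ R) ts)) ⟩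
        c * ℕtoℚ (G ℕ.+ Bt)
          ≡⟨ cong (c *_) (ℕtoℚ-+ G Bt) ⟩
        c * (ℕtoℚ G + ℕtoℚ Bt) ∎
        where
        open ≤-Reasoning
        w = length Vs
        b = ∑[ x ∈ Vs ] ∑[ y ∈ Vs ] isFalse (R (elt p N x) (elt p N y))
        badPairs-W : badPairs R W ≡ b
        badPairs-W = trans (∑-map (elt p N) Vs _) (∑-cong Vs (λ x → ∑-map (elt p N) Vs _))
        0≤e : 0ℚ ≤ e
        0≤e = *-nonNeg (square-nonNeg ε) (0≤ℕtoℚ p)
        0≤K²w^K : 0ℚ ≤ ℕtoℚ K₂ * ℕtoℚ K₂ * ℕtoℚ (w ^ K)
        0≤K²w^K = *-nonNeg (square-nonNeg (ℕtoℚ K₂)) (0≤ℕtoℚ (w ^ K))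
        reassoc : ∀ k v b e → k * k * (v * b) * e ≡ k * k * v * (b * e)
        reassoc = ℚ-Solver.solve-∀ ℚ-ring
        regroup : ∀ k v w → k * k * v * (ℕtoℚ 192 * (w * w)) ≡ ℕtoℚ 192 * k * k * (w * (w * v))
        regroup = ℚ-Solver.solve-∀ ℚ-ring

open Counting

open import Data.Nat using (_≥_)
open import Data.Nat.Primality using (Prime; ¬prime[0]; ¬prime[1])
open import Data.Rational using (ℚ; 0ℚ; 1ℚ; _≤_; _<_; _*_; _-_)
open import Data.Rational.Properties using (<⇒≤)

corollary1 : Σ ℚ λ C₁ → Σ ℚ λ C₂ → (0ℚ < C₁) × (0ℚ < C₂) ×
    ((ε : ℚ) → 0ℚ < ε → ε < 1ℚ →
     (N : ℕ) → N ≥ 1 → (K : ℕ) → K ≥ 2 → (p : ℕ) → Prime p →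
     C₁ < ε * ℕtoℚ p →
     ℕtoℚ (countAll p N K) * (ε * ε * ℕtoℚ p - C₂ * ℕtoℚ K * ℕtoℚ K)
       ≤ ℕtoℚ (countGood p N K ε) * (ε * ε * ℕtoℚ p))
-- The bound holds for every prime.
corollary1 = ℕtoℚ 1 , ℕtoℚ 192 , 0<ℕtoℚ-suc 0 , 0<ℕtoℚ-suc 191 , bound
  where
  bound : (ε : ℚ) → 0ℚ < ε → ε < 1ℚ → (N : ℕ) → N ≥ 1 → (K : ℕ) → K ≥ 2 → (p : ℕ) → Prime p →
          ℕtoℚ 1 < ε * ℕtoℚ p →
          ℕtoℚ (countAll p N K) * (ε * ε * ℕtoℚ p - ℕtoℚ 192 * ℕtoℚ K * ℕtoℚ K)
            ≤ ℕtoℚ (countGood p N K ε) * (ε * ε * ℕtoℚ p)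
  bound ε 0<ε ε<1 zero     ()
  bound ε 0<ε ε<1 (suc N₀) _ 1             (s≤s ())
  bound ε 0<ε ε<1 (suc N₀) _ (suc (suc K)) _ 0             isPrime _ = ⊥-elim (¬prime[0] isPrime)
  bound ε 0<ε ε<1 (suc N₀) _ (suc (suc K)) _ 1             isPrime _ = ⊥-elim (¬prime[1] isPrime)
  bound ε 0<ε ε<1 (suc N₀) _ (suc (suc K)) _ (suc (suc m)) isPrime _ = count-bound isPrime N₀ (<⇒≤ 0<ε) (<⇒≤ ε<1) K
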